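{- Let $m\geq 3$ and $n\in \mathbb{N}=\{1,2,\dots\}$. Then \[ p'_{m}(n)=\sum_{k=1}^\infty (-1)^{k+1} \big(p'_{m}(n- P_{m+2,k})+p'_m(n-Q_{m+2,k})\big), \] where $P_{g,k}=\frac{k((g-2)k-(g-4))}{2}$ and $Q_{g,k}=\frac{k((g-2)k+(g-4))}{2}$.
   Context: For $m\ge3$, $p'_m(n)$ is the number of partitions of $n$ in which every part is congruent to $0$, $1$ or $m-1$ modulo $m$; equivalently $\sum_{n\ge0}p'_m(n)q^n=\frac{1}{(q;q^m)_\infty (q^{m-1};q^m)_\infty (q^m; q^m)_\infty}$, where $(a;q)_\infty=\prod_{k\ge0}(1-aq^k)$. Conventions: $p'_m(0)=1$ and $p'_m(x)=0$ for $x\notin\mathbb{N}_0$. -}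

module Defs where

open import Data.Nat using (ℕ; zero; suc; _+_; _*_; _∸_; _/_; _≤?_)
open import Data.Nat.Divisibility using (_∣_; _∣?_)
open import Data.Integer as ℤ using (ℤ; +_; -[1+_])
open import Data.List using (List; []; _∷_; map; concatMap; filter; upTo; length)
open import Data.List.Relation.Unary.All using (all?)
open import Data.Sum using (_⊎_)
open import Relation.Nullary.Decidable using (Dec; _⊎-dec_)

-- A part j (j ≥ 1) is allowed for modulus m iff j ≡ 0, 1 or m-1 (mod m),
-- written via divisibility: m ∣ j, m ∣ j - 1, m ∣ j + 1.
Allowed : ℕ → ℕ → Set
Allowed m j = m ∣ j ⊎ (m ∣ (j ∸ 1) ⊎ m ∣ (j + 1))

allowed? : (m j : ℕ) → Dec (Allowed m j)
allowed? m j = (m ∣? j) ⊎-dec ((m ∣? (j ∸ 1)) ⊎-dec (m ∣? (j + 1)))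

-- gen fuel k n : all partitions of n (as non-increasing lists of positive
-- parts) whose largest part is ≤ k; fuel ≥ n guarantees completeness.
gen : ℕ → ℕ → ℕ → List (List ℕ)
gen _       k zero    = [] ∷ []
gen zero    k (suc n) = []
gen (suc f) k (suc n) =
  concatMap (λ j → map (j ∷_) (gen f j (suc n ∸ j)))
            (filter (_≤? k) (map suc (upTo (suc n))))

partitions : ℕ → List (List ℕ)
partitions n = gen n n n

p′ : ℕ → ℕ → ℕ
p′ m n = length (filter (all? (allowed? m)) (partitions n))

p′ℤ : ℕ → ℤ → ℤ
p′ℤ m (+ n)    = + (p′ m n)
p′ℤ m -[1+ _ ] = + 0

P : ℕ → ℕ → ℕ
P g k = (k * ((g ∸ 2) * k ∸ (g ∸ 4))) / 2

Q : ℕ → ℕ → ℕ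
Q g k = (k * ((g ∸ 2) * k + (g ∸ 4))) / 2

sumFrom1 : ℕ → (ℕ → ℤ) → ℤ
sumFrom1 zero    f = + 0
sumFrom1 (suc N) f = sumFrom1 N f ℤ.+ f (suc N)

term : ℕ → ℕ → ℕ → ℤ
term m n k =
  (ℤ.- ℤ.1ℤ) ℤ.^ (k + 1) ℤ.*
    (p′ℤ m (+ n ℤ.- + P (m + 2) k) ℤ.+ p′ℤ m (+ n ℤ.- + Q (m + 2) k))

-- Let P_L(q) count the partitions into allowed parts ≤ L; then P_L(q) ∏_{j ≤ L allowed} (1 - q^j) = 1.
-- For L = N m the allowed product is (q^m;q^m)_N (q;q^m)_N (q^{m-1};q^m)_N. Up to a sign and a power
-- of q, the last two factors are ∏_{i<2N} (q^{N m} - q^{1 + i m}), which the finite q-binomial theorem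
-- expands as Σ_j (-1)^j q^{e_j} [2N, j]_{q^m}. Multiplied by (q^m;q^m)_N, the terms j = N ± k become
-- (-1)^k q^{P_{m+2,k}} resp. (-1)^k q^{Q_{m+2,k}} modulo q^{N+1}, because (q^m;q^m)_N [2N, N ± k]_{q^m}
-- is 1 modulo q^{(N-k+1)m}. This is the Jacobi triple product truncated at degree N, and comparing
-- coefficients of q^n in P_{n m}(q) times it, for N = n, gives the recurrence.

module Submission where

open import Defs
open import Data.Nat using (ℕ; zero; suc; _≤_; _<_; z≤n; s≤s; _∸_; _/_; _≤?_; _⊓_; >-nonZero)
  renaming (_+_ to _+ℕ_; _*_ to _*ℕ_)
import Data.Nat.Properties as ℕ
open import Data.Nat.Induction using (<-rec)
open import Data.Nat.DivMod using (m*n/n≡m)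
open import Data.Nat.Divisibility using (_∣_; ∣m+n∣m⇒∣n; n∣m*n; >⇒∤)
open import Data.Nat.ListAction using (sum)
open import Data.Integer using (ℤ; +_; -[1+_]; 0ℤ; 1ℤ; _⊖_)
  renaming (_+_ to _+ᶻ_; _*_ to _*ᶻ_; -_ to -ᶻ_; _-_ to _-ᶻ_; _^_ to _^ᶻ_)
import Data.Integer.Properties as ℤ
open import Data.List using (List; []; _∷_; _++_; map; filter; length; concatMap; applyUpTo; upTo)
open import Data.List.Properties using (filter-accept; filter-reject; filter-++; length-++)
open import Data.List.Relation.Unary.All using (All; []; _∷_; all?)
open import Data.Sum using (inj₁; inj₂)
open import Data.Empty using (⊥-elim)
open import Function using (_∘_)
open import Relation.Nullary using (Dec; yes; no; ¬_)
open import Relation.Binary.PropositionalEquality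
  using (_≡_; refl; sym; trans; cong; cong₂; subst; _≗_; module ≡-Reasoning)
open import Data.Integer.Tactic.RingSolver using (solve-∀)
open import Data.Nat.Tactic.RingSolver using () renaming (solve-∀ to solve-∀ℕ)

-- Formal power series in q, as coefficient sequences

infixl 6 _⊕_ _⊝_
infixr 7 _⊙_
infixr 8 [1-q^_]_ ∏[1-q^_]_

Series : Set
Series = ℕ → ℤ

𝟙 : Series
𝟙 zero    = 1ℤ
𝟙 (suc _) = 0ℤ

𝟘 : Series
𝟘 _ = 0ℤ

_⊕_ : Series → Series → Series
(f ⊕ g) n = f n +ᶻ g n

_⊝_ : Series → Series → Series
(f ⊝ g) n = f n -ᶻ g n

_⊙_ : ℤ → Series → Series
(c ⊙ f) n = c *ᶻ f n

shift : ℕ → Series → Series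
shift zero    f         = f
shift (suc s) f zero    = 0ℤ
shift (suc s) f (suc n) = shift s f n

[1-q^_]_ : ℕ → Series → Series
[1-q^ a ] f = f ⊝ shift a f

shift-cong : ∀ s {f g} → f ≗ g → shift s f ≗ shift s g
shift-cong zero    e x       = e x
shift-cong (suc s) e zero    = refl
shift-cong (suc s) e (suc x) = shift-cong s e x

shift-⊕ : ∀ s f g → shift s (f ⊕ g) ≗ shift s f ⊕ shift s g
shift-⊕ zero    f g x       = refl
shift-⊕ (suc s) f g zero    = refl
shift-⊕ (suc s) f g (suc x) = shift-⊕ s f g x

shift-⊝ : ∀ s f g → shift s (f ⊝ g) ≗ shift s f ⊝ shift s g
shift-⊝ zero    f g x       = refl
shift-⊝ (suc s) f g zero    = refl
shift-⊝ (suc s) f g (suc x) = shift-⊝ s f g x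

shift-⊙ : ∀ s c f → shift s (c ⊙ f) ≗ c ⊙ shift s f
shift-⊙ zero    c f x       = refl
shift-⊙ (suc s) c f zero    = sym (ℤ.*-zeroʳ c)
shift-⊙ (suc s) c f (suc x) = shift-⊙ s c f x

shift-shift : ∀ a b f → shift a (shift b f) ≗ shift (a +ℕ b) f
shift-shift zero    b f x       = refl
shift-shift (suc a) b f zero    = refl
shift-shift (suc a) b f (suc x) = shift-shift a b f x

shift-comm : ∀ a b f → shift a (shift b f) ≗ shift b (shift a f)
shift-comm a b f x = begin
  shift a (shift b f) x ≡⟨ shift-shift a b f x ⟩
  shift (a +ℕ b) f x    ≡⟨ cong (λ s → shift s f x) (ℕ.+-comm a b) ⟩
  shift (b +ℕ a) f x    ≡⟨ shift-shift b a f x ⟨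
  shift b (shift a f) x ∎
  where open ≡-Reasoning

shift-below : ∀ s f {x} → x < s → shift s f x ≡ 0ℤ
shift-below (suc s) f {zero}  _         = refl
shift-below (suc s) f {suc x} (s≤s x<s) = shift-below s f x<s

shift-+ : ∀ s f y → shift s f (s +ℕ y) ≡ f y
shift-+ zero    f y = refl
shift-+ (suc s) f y = shift-+ s f y

shift-𝟘 : ∀ s {f} → f ≗ 𝟘 → shift s f ≗ 𝟘
shift-𝟘 zero    e x       = e x
shift-𝟘 (suc s) e zero    = refl
shift-𝟘 (suc s) e (suc x) = shift-𝟘 s e x

shift-suc : ∀ a F → shift (suc a) F ≗ shift 1 (shift a F)
shift-suc a F x = sym (shift-shift 1 a F x)

shift-⊙-shift : ∀ a c e f → shift a (c ⊙ shift e f) ≗ c ⊙ shift (a +ℕ e) f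
shift-⊙-shift a c e f x = trans (shift-⊙ a c (shift e f) x) (cong (c *ᶻ_) (shift-shift a e f x))

shift-[1-q^] : ∀ a c f → shift a ([1-q^ c ] f) ≗ shift a f ⊝ shift (a +ℕ c) f
shift-[1-q^] a c f x = trans (shift-⊝ a f (shift c f) x) (cong (λ z → shift a f x -ᶻ z) (shift-shift a c f x))

shift-+-+ : ∀ c e f y → shift (c +ℕ e) f (c +ℕ y) ≡ shift e f y
shift-+-+ c e f y = trans (sym (shift-shift c e f (c +ℕ y))) (shift-+ c (shift e f) y)

shift-∸ : ∀ {s n} f → s ≤ n → shift s f n ≡ f (n ∸ s)
shift-∸ {s} {n} f s≤n = trans (cong (shift s f) (sym (ℕ.m+[n∸m]≡n s≤n))) (shift-+ s f (n ∸ s))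

record Linear (F : Series → Series) : Set where
  field
    ≗-cong      : ∀ {f g} → f ≗ g → F f ≗ F g
    ⊕-hom       : ∀ f g → F (f ⊕ g) ≗ F f ⊕ F g
    ⊙-hom       : ∀ c f → F (c ⊙ f) ≗ c ⊙ F f
    shift-hom   : ∀ s f → F (shift s f) ≗ shift s (F f)

open Linear public

module _ {F : Series → Series} (L : Linear F) where

  linear-⊝ : ∀ f g → F (f ⊝ g) ≗ F f ⊝ F g
  linear-⊝ f g x = begin
      F (f ⊝ g) x                    ≡⟨ ≗-cong L (λ y → minus (f y) (g y)) x ⟩
      F (f ⊕ (-ᶻ 1ℤ) ⊙ g) x          ≡⟨ ⊕-hom L f ((-ᶻ 1ℤ) ⊙ g) x ⟩
      F f x +ᶻ F ((-ᶻ 1ℤ) ⊙ g) x     ≡⟨ cong (F f x +ᶻ_) (⊙-hom L (-ᶻ 1ℤ) g x) ⟩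
      F f x +ᶻ (-ᶻ 1ℤ) *ᶻ F g x      ≡⟨ minus (F f x) (F g x) ⟨
      F f x -ᶻ F g x                 ∎
    where
    open ≡-Reasoning
    minus : ∀ a b → a -ᶻ b ≡ a +ᶻ (-ᶻ 1ℤ) *ᶻ b
    minus = solve-∀

  linear-𝟘 : F 𝟘 ≗ 𝟘
  linear-𝟘 x = begin
      F 𝟘 x          ≡⟨ ≗-cong L (λ _ → ℤ.*-zeroˡ 0ℤ) x ⟨
      F (0ℤ ⊙ 𝟘) x   ≡⟨ ⊙-hom L 0ℤ 𝟘 x ⟩
      0ℤ *ᶻ F 𝟘 x    ≡⟨ ℤ.*-zeroˡ (F 𝟘 x) ⟩
      0ℤ             ∎
    where open ≡-Reasoning

  linear-[1-q^] : ∀ a f → F ([1-q^ a ] f) ≗ [1-q^ a ] F f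
  linear-[1-q^] a f x = trans (linear-⊝ f (shift a f) x) (cong (λ z → F f x -ᶻ z) (shift-hom L a f x))

id-linear : Linear (λ f → f)
id-linear = record
  { ≗-cong = λ e → e ; ⊕-hom = λ _ _ _ → refl ; ⊙-hom = λ _ _ _ → refl ; shift-hom = λ _ _ _ → refl }

∘-linear : ∀ {F G} → Linear F → Linear G → Linear (F ∘ G)
∘-linear {F} {G} LF LG = record
  { ≗-cong    = λ e → ≗-cong LF (≗-cong LG e)
  ; ⊕-hom     = λ f g x → trans (≗-cong LF (⊕-hom LG f g) x) (⊕-hom LF (G f) (G g) x)
  ; ⊙-hom     = λ c f x → trans (≗-cong LF (⊙-hom LG c f) x) (⊙-hom LF c (G f) x)
  ; shift-hom = λ s f x → trans (≗-cong LF (shift-hom LG s f) x) (shift-hom LF s (G f) x)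
  }

shift-linear : ∀ s → Linear (shift s)
shift-linear s = record
  { ≗-cong = shift-cong s ; ⊕-hom = shift-⊕ s ; ⊙-hom = shift-⊙ s ; shift-hom = λ t f → shift-comm s t f }

[1-q^]-cong : ∀ a {f g} → f ≗ g → [1-q^ a ] f ≗ [1-q^ a ] g
[1-q^]-cong a e x = cong₂ _-ᶻ_ (e x) (shift-cong a e x)

[1-q^]-linear : ∀ a → Linear ([1-q^_]_ a)
[1-q^]-linear a = record
  { ≗-cong    = [1-q^]-cong a
  ; ⊕-hom     = λ f g x → trans (cong (λ z → f x +ᶻ g x -ᶻ z) (shift-⊕ a f g x)) (interchange (f x) (g x) _ _)
  ; ⊙-hom     = λ c f x → trans (cong (λ z → c *ᶻ f x -ᶻ z) (shift-⊙ a c f x)) (distrib c (f x) _)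
  ; shift-hom = λ s f x → trans (cong (λ z → shift s f x -ᶻ z) (shift-comm a s f x)) (sym (shift-⊝ s f (shift a f) x))
  }
  where
  interchange : ∀ a b c d → (a +ᶻ b) -ᶻ (c +ᶻ d) ≡ (a -ᶻ c) +ᶻ (b -ᶻ d)
  interchange = solve-∀
  distrib : ∀ c a b → c *ᶻ a -ᶻ c *ᶻ b ≡ c *ᶻ (a -ᶻ b)
  distrib = solve-∀

[1-q^]-⊙-shift : ∀ b c e f → [1-q^ b ] (c ⊙ shift e f) ≗ c ⊙ shift e ([1-q^ b ] f)
[1-q^]-⊙-shift b c e f x =
  trans (⊙-hom ([1-q^]-linear b) c (shift e f) x) (cong (c *ᶻ_) (shift-hom ([1-q^]-linear b) e f x))

[1-q^]-telescope : ∀ a c f → [1-q^ a ] f ⊕ [1-q^ c ] shift a f ≗ [1-q^ c +ℕ a ] f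
[1-q^]-telescope a c f x =
  trans (cancel (f x) (shift a f x) _) (cong (λ z → f x -ᶻ z) (shift-shift c a f x))
  where
  cancel : ∀ x u v → (x -ᶻ u) +ᶻ (u -ᶻ v) ≡ x -ᶻ v
  cancel = solve-∀

∏[1-q^_]_ : List ℕ → Series → Series
∏[1-q^ []     ] f = f
∏[1-q^ a ∷ as ] f = [1-q^ a ] ∏[1-q^ as ] f

∏[1-q^]-linear : ∀ as → Linear (∏[1-q^_]_ as)
∏[1-q^]-linear []       = id-linear
∏[1-q^]-linear (a ∷ as) = ∘-linear ([1-q^]-linear a) (∏[1-q^]-linear as)

linear-∏[1-q^] : ∀ {F} → Linear F → ∀ as f → F (∏[1-q^ as ] f) ≗ ∏[1-q^ as ] F f
linear-∏[1-q^] L []       f x = refl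
linear-∏[1-q^] L (a ∷ as) f x =
  trans (linear-[1-q^] L a _ x) ([1-q^]-cong a (linear-∏[1-q^] L as f) x)

∏[1-q^]-++ : ∀ as bs f → ∏[1-q^ as ++ bs ] f ≡ ∏[1-q^ as ] ∏[1-q^ bs ] f
∏[1-q^]-++ []       bs f = refl
∏[1-q^]-++ (a ∷ as) bs f = cong ([1-q^_]_ a) (∏[1-q^]-++ as bs f)

infix 4 _≡_mod-q^_

_≡_mod-q^_ : Series → Series → ℕ → Set
f ≡ g mod-q^ M = ∀ {x} → x < M → f x ≡ g x

mod-trans : ∀ {f g h M} → f ≡ g mod-q^ M → g ≡ h mod-q^ M → f ≡ h mod-q^ M
mod-trans fg gh x<M = trans (fg x<M) (gh x<M)

shift-mod : ∀ s {f g M} → f ≡ g mod-q^ M → shift s f ≡ shift s g mod-q^ (s +ℕ M)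
shift-mod zero    fg x<M             = fg x<M
shift-mod (suc s) fg {zero}  _       = refl
shift-mod (suc s) fg {suc x} (s≤s x<) = shift-mod s fg x<

[1-q^]-mod : ∀ {M a} → M ≤ a → ∀ f → [1-q^ a ] f ≡ f mod-q^ M
[1-q^]-mod {a = a} M≤a f {x} x<M =
  trans (cong (λ z → f x -ᶻ z) (shift-below a f (ℕ.<-≤-trans x<M M≤a))) (ℤ.+-identityʳ (f x))

∏[1-q^]-mod : ∀ {M as} → All (M ≤_) as → ∀ f → ∏[1-q^ as ] f ≡ f mod-q^ M
∏[1-q^]-mod [] f x<M = refl
∏[1-q^]-mod {as = _ ∷ as} (M≤a ∷ M≤as) f = mod-trans ([1-q^]-mod M≤a (∏[1-q^ as ] f)) (∏[1-q^]-mod M≤as f)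

[1-q^]-injective : ∀ {a} → 1 ≤ a → ∀ {f g} → [1-q^ a ] f ≗ [1-q^ a ] g → f ≗ g
[1-q^]-injective {a} 1≤a {f} {g} e = <-rec (λ x → f x ≡ g x) agree
  where
  split : ∀ h x → h x ≡ ([1-q^ a ] h) x +ᶻ shift a h x
  split h x = solve (h x) (shift a h x)
    where
    solve : ∀ p q → p ≡ (p -ᶻ q) +ᶻ q
    solve = solve-∀
  agree : ∀ x → f ≡ g mod-q^ x → f x ≡ g x
  agree x f≡g = begin
    f x                                ≡⟨ split f x ⟩
    ([1-q^ a ] f) x +ᶻ shift a f x     ≡⟨ cong₂ _+ᶻ_ (e x) (shift-mod a f≡g (ℕ.m<n+m x 1≤a)) ⟩
    ([1-q^ a ] g) x +ᶻ shift a g x     ≡⟨ split g x ⟨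
    g x                                ∎
    where open ≡-Reasoning

∏[1-q^]-injective : ∀ {as} → All (1 ≤_) as → ∀ {f g} → ∏[1-q^ as ] f ≗ ∏[1-q^ as ] g → f ≗ g
∏[1-q^]-injective []         e = e
∏[1-q^]-injective (1≤a ∷ ps) e = ∏[1-q^]-injective ps ([1-q^]-injective 1≤a e)

-- Finite sums and convolution

Σ< : ℕ → (ℕ → ℤ) → ℤ
Σ< zero    g = 0ℤ
Σ< (suc k) g = g 0 +ᶻ Σ< k (g ∘ suc)

Σ<-cong : ∀ k {g h : ℕ → ℤ} → (∀ {i} → i < k → g i ≡ h i) → Σ< k g ≡ Σ< k h
Σ<-cong zero    e = refl
Σ<-cong (suc k) e = cong₂ _+ᶻ_ (e (s≤s z≤n)) (Σ<-cong k (e ∘ s≤s))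

Σ<-0 : ∀ k → Σ< k (λ _ → 0ℤ) ≡ 0ℤ
Σ<-0 zero    = refl
Σ<-0 (suc k) = trans (ℤ.+-identityˡ _) (Σ<-0 k)

Σ<-+ : ∀ k (g h : ℕ → ℤ) → Σ< k (λ i → g i +ᶻ h i) ≡ Σ< k g +ᶻ Σ< k h
Σ<-+ zero    g h = refl
Σ<-+ (suc k) g h =
  trans (cong (g 0 +ᶻ h 0 +ᶻ_) (Σ<-+ k (g ∘ suc) (h ∘ suc))) (interchange (g 0) (h 0) _ _)
  where
  interchange : ∀ a b c d → a +ᶻ b +ᶻ (c +ᶻ d) ≡ a +ᶻ c +ᶻ (b +ᶻ d)
  interchange = solve-∀

Σ<-* : ∀ k c (g : ℕ → ℤ) → Σ< k (λ i → c *ᶻ g i) ≡ c *ᶻ Σ< k g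
Σ<-* zero    c g = sym (ℤ.*-zeroʳ c)
Σ<-* (suc k) c g = trans (cong (c *ᶻ g 0 +ᶻ_) (Σ<-* k c (g ∘ suc))) (sym (ℤ.*-distribˡ-+ c (g 0) _))

Σ<-neg : ∀ k (g : ℕ → ℤ) → Σ< k (λ i → -ᶻ g i) ≡ -ᶻ Σ< k g
Σ<-neg zero    g = refl
Σ<-neg (suc k) g = trans (cong (-ᶻ g 0 +ᶻ_) (Σ<-neg k (g ∘ suc))) (sym (ℤ.neg-distrib-+ (g 0) _))

Σ<-last : ∀ k (g : ℕ → ℤ) → Σ< (suc k) g ≡ Σ< k g +ᶻ g k
Σ<-last zero    g = ℤ.+-comm (g 0) 0ℤ
Σ<-last (suc k) g = trans (cong (g 0 +ᶻ_) (Σ<-last k (g ∘ suc))) (sym (ℤ.+-assoc (g 0) _ _))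

Σ<-rotate : ∀ k (g : ℕ → ℤ) → g k ≡ 0ℤ → Σ< k g ≡ g 0 +ᶻ Σ< k (g ∘ suc)
Σ<-rotate k g gk≡0 = begin
  Σ< k g          ≡⟨ ℤ.+-identityʳ (Σ< k g) ⟨
  Σ< k g +ᶻ 0ℤ    ≡⟨ cong (Σ< k g +ᶻ_) gk≡0 ⟨
  Σ< k g +ᶻ g k   ≡⟨ Σ<-last k g ⟨
  Σ< (suc k) g    ∎
  where open ≡-Reasoning

sumFrom1-cong : ∀ N {f g : ℕ → ℤ} → (∀ {k} → 1 ≤ k → k ≤ N → f k ≡ g k) → sumFrom1 N f ≡ sumFrom1 N g
sumFrom1-cong zero    e = refl
sumFrom1-cong (suc N) e =
  cong₂ _+ᶻ_ (sumFrom1-cong N (λ 1≤k k≤N → e 1≤k (ℕ.m≤n⇒m≤1+n k≤N))) (e (s≤s z≤n) ℕ.≤-refl)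

sumFrom1-* : ∀ N c (f : ℕ → ℤ) → sumFrom1 N (λ k → c *ᶻ f k) ≡ c *ᶻ sumFrom1 N f
sumFrom1-* zero    c f = sym (ℤ.*-zeroʳ c)
sumFrom1-* (suc N) c f =
  trans (cong (_+ᶻ c *ᶻ f (suc N)) (sumFrom1-* N c f)) (sym (ℤ.*-distribˡ-+ c _ _))

sumFrom1-neg : ∀ N (f : ℕ → ℤ) → sumFrom1 N (λ k → -ᶻ f k) ≡ -ᶻ sumFrom1 N f
sumFrom1-neg zero    f = refl
sumFrom1-neg (suc N) f =
  trans (cong (_+ᶻ -ᶻ f (suc N)) (sumFrom1-neg N f)) (sym (ℤ.neg-distrib-+ (sumFrom1 N f) (f (suc N))))

Σ<-around-middle : ∀ N (g : ℕ → ℤ) →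
  Σ< (suc (N +ℕ N)) g ≡ g N +ᶻ sumFrom1 N (λ k → g (N +ℕ k) +ᶻ g (N ∸ k))
Σ<-around-middle zero    g = refl
Σ<-around-middle (suc M) g = begin
    g 0 +ᶻ Σ< (suc (M +ℕ suc M)) (g ∘ suc)
      ≡⟨ cong (λ z → g 0 +ᶻ Σ< (suc z) (g ∘ suc)) (ℕ.+-suc M M) ⟩
    g 0 +ᶻ Σ< (suc (suc (M +ℕ M))) (g ∘ suc)
      ≡⟨ cong (g 0 +ᶻ_) (Σ<-last (suc (M +ℕ M)) (g ∘ suc)) ⟩
    g 0 +ᶻ (Σ< (suc (M +ℕ M)) (g ∘ suc) +ᶻ g (2+2M))
      ≡⟨ cong (λ z → g 0 +ᶻ (z +ᶻ g (2+2M))) (Σ<-around-middle M (g ∘ suc)) ⟩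
    g 0 +ᶻ ((g (suc M) +ᶻ S) +ᶻ g (2+2M))
      ≡⟨ regroup (g 0) (g (suc M)) S (g (2+2M)) ⟩
    g (suc M) +ᶻ (S +ᶻ (g (2+2M) +ᶻ g 0))
      ≡⟨ cong₂ (λ u v → g (suc M) +ᶻ (u +ᶻ v))
           (sumFrom1-cong M (λ {k} _ k≤M → cong (λ z → g (suc (M +ℕ k)) +ᶻ g z) (sym (ℕ.+-∸-assoc 1 k≤M))))
           (cong₂ _+ᶻ_ (cong (g ∘ suc) (sym (ℕ.+-suc M M))) (cong g (sym (ℕ.n∸n≡0 M)))) ⟩
    g (suc M) +ᶻ (sumFrom1 M pair +ᶻ pair (suc M)) ∎
  where
  open ≡-Reasoning
  2+2M = suc (suc (M +ℕ M))
  S = sumFrom1 M (λ k → g (suc (M +ℕ k)) +ᶻ g (suc (M ∸ k)))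
  pair = λ k → g (suc M +ℕ k) +ᶻ g (suc M ∸ k)
  regroup : ∀ a b c d → a +ᶻ ((b +ᶻ c) +ᶻ d) ≡ b +ᶻ (c +ᶻ (d +ᶻ a))
  regroup = solve-∀

Σ<ˢ : ℕ → (ℕ → Series) → Series
Σ<ˢ k A y = Σ< k (λ j → A j y)

sumFrom1ˢ : ℕ → (ℕ → Series) → Series
sumFrom1ˢ N A y = sumFrom1 N (λ k → A k y)

module _ {F : Series → Series} (L : Linear F) where

  linear-Σ<ˢ : ∀ k A → F (Σ<ˢ k A) ≗ Σ<ˢ k (F ∘ A)
  linear-Σ<ˢ zero    A x = linear-𝟘 L x
  linear-Σ<ˢ (suc k) A x =
    trans (⊕-hom L (A 0) (Σ<ˢ k (A ∘ suc)) x) (cong (F (A 0) x +ᶻ_) (linear-Σ<ˢ k (A ∘ suc) x))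

  linear-sumFrom1ˢ : ∀ N A → F (sumFrom1ˢ N A) ≗ sumFrom1ˢ N (F ∘ A)
  linear-sumFrom1ˢ zero    A x = linear-𝟘 L x
  linear-sumFrom1ˢ (suc N) A x =
    trans (⊕-hom L (sumFrom1ˢ N A) (A (suc N)) x) (cong (_+ᶻ F (A (suc N)) x) (linear-sumFrom1ˢ N A x))

sign : ℕ → ℤ
sign j = (-ᶻ 1ℤ) ^ᶻ j

sign-suc : ∀ j x → sign (suc j) *ᶻ x ≡ -ᶻ (sign j *ᶻ x)
sign-suc j x = trans (ℤ.*-assoc (-ᶻ 1ℤ) (sign j) x) (ℤ.-1*i≡-i (sign j *ᶻ x))

sign-+ : ∀ a b → sign (a +ℕ b) ≡ sign a *ᶻ sign b
sign-+ = ℤ.^-distribˡ-+-* (-ᶻ 1ℤ)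

sign*sign : ∀ a → sign a *ᶻ sign a ≡ 1ℤ
sign*sign zero    = refl
sign*sign (suc a) = trans (square-neg (sign a)) (sign*sign a)
  where
  square-neg : ∀ s → (-ᶻ 1ℤ *ᶻ s) *ᶻ (-ᶻ 1ℤ *ᶻ s) ≡ s *ᶻ s
  square-neg = solve-∀

sign-cancel : ∀ a x → sign a *ᶻ (sign a *ᶻ x) ≡ x
sign-cancel a x = begin
  sign a *ᶻ (sign a *ᶻ x) ≡⟨ ℤ.*-assoc (sign a) (sign a) x ⟨
  (sign a *ᶻ sign a) *ᶻ x ≡⟨ cong (_*ᶻ x) (sign*sign a) ⟩
  1ℤ *ᶻ x                 ≡⟨ ℤ.*-identityˡ x ⟩
  x                       ∎
  where open ≡-Reasoning

sign-+-cancel : ∀ N k → sign N *ᶻ sign (N +ℕ k) ≡ sign k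
sign-+-cancel N k = trans (cong (sign N *ᶻ_) (sign-+ N k)) (sign-cancel N (sign k))

sign-∸-cancel : ∀ N k → k ≤ N → sign N *ᶻ sign (N ∸ k) ≡ sign k
sign-∸-cancel N k k≤N = begin
  sign N *ᶻ sign (N ∸ k)                  ≡⟨ cong (λ z → sign z *ᶻ sign (N ∸ k)) (sym (ℕ.m∸n+n≡m k≤N)) ⟩
  sign (N ∸ k +ℕ k) *ᶻ sign (N ∸ k)       ≡⟨ cong (_*ᶻ sign (N ∸ k)) (sign-+ (N ∸ k) k) ⟩
  sign (N ∸ k) *ᶻ sign k *ᶻ sign (N ∸ k)  ≡⟨ ℤ.*-comm _ (sign (N ∸ k)) ⟩
  sign (N ∸ k) *ᶻ (sign (N ∸ k) *ᶻ sign k) ≡⟨ sign-cancel (N ∸ k) (sign k) ⟩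
  sign k                                   ∎
  where open ≡-Reasoning

infixl 7 _∗_

_∗_ : Series → Series → Series
(f ∗ g) n = Σ< (suc n) (λ i → f i *ᶻ g (n ∸ i))

∗-cong : ∀ {f f′ g g′} → f ≗ f′ → g ≗ g′ → f ∗ g ≗ f′ ∗ g′
∗-cong ef eg n = Σ<-cong (suc n) (λ {i} _ → cong₂ _*ᶻ_ (ef i) (eg (n ∸ i)))

𝟙-∗ : ∀ g → 𝟙 ∗ g ≗ g
𝟙-∗ g n = begin
  1ℤ *ᶻ g n +ᶻ Σ< n (λ i → 0ℤ *ᶻ g (n ∸ suc i)) ≡⟨ cong₂ _+ᶻ_ (ℤ.*-identityˡ (g n)) (Σ<-cong n (λ {i} _ → ℤ.*-zeroˡ (g (n ∸ suc i)))) ⟩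
  g n +ᶻ Σ< n (λ _ → 0ℤ)                        ≡⟨ cong (g n +ᶻ_) (Σ<-0 n) ⟩
  g n +ᶻ 0ℤ                                     ≡⟨ ℤ.+-identityʳ (g n) ⟩
  g n                                           ∎
  where open ≡-Reasoning

shift1-∗ : ∀ f g → shift 1 f ∗ g ≗ shift 1 (f ∗ g)
shift1-∗ f g zero    = refl
shift1-∗ f g (suc n) = ℤ.+-identityˡ _

∗-shift1 : ∀ f g → f ∗ shift 1 g ≗ shift 1 (f ∗ g)
∗-shift1 f g zero    = trans (ℤ.+-identityʳ (f 0 *ᶻ 0ℤ)) (ℤ.*-zeroʳ (f 0))
∗-shift1 f g (suc n) = begin
    Σ< (suc (suc n)) summand
      ≡⟨ Σ<-last (suc n) summand ⟩
    Σ< (suc n) summand +ᶻ f (suc n) *ᶻ shift 1 g (n ∸ n)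
      ≡⟨ cong₂ _+ᶻ_ (Σ<-cong (suc n) (λ {i} i≤n → cong (λ z → f i *ᶻ shift 1 g z) (ℕ.+-∸-assoc 1 (ℕ.<⇒≤pred i≤n))))
                    (trans (cong (λ z → f (suc n) *ᶻ shift 1 g z) (ℕ.n∸n≡0 n)) (ℤ.*-zeroʳ (f (suc n)))) ⟩
    (f ∗ g) n +ᶻ 0ℤ
      ≡⟨ ℤ.+-identityʳ _ ⟩
    (f ∗ g) n ∎
  where
  open ≡-Reasoning
  summand = λ i → f i *ᶻ shift 1 g (suc n ∸ i)

shift-∗ : ∀ a f g → shift a f ∗ g ≗ shift a (f ∗ g)
shift-∗ zero    f g n = refl
shift-∗ (suc a) f g n = begin
  (shift (suc a) f ∗ g) n     ≡⟨ ∗-cong {g = g} (shift-suc a f) (λ _ → refl) n ⟩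
  (shift 1 (shift a f) ∗ g) n ≡⟨ shift1-∗ (shift a f) g n ⟩
  shift 1 (shift a f ∗ g) n   ≡⟨ shift-cong 1 (shift-∗ a f g) n ⟩
  shift 1 (shift a (f ∗ g)) n ≡⟨ shift-suc a (f ∗ g) n ⟨
  shift (suc a) (f ∗ g) n     ∎
  where open ≡-Reasoning

∗-shift : ∀ a f g → f ∗ shift a g ≗ shift a (f ∗ g)
∗-shift zero    f g n = refl
∗-shift (suc a) f g n = begin
  (f ∗ shift (suc a) g) n     ≡⟨ ∗-cong {f = f} (λ _ → refl) (shift-suc a g) n ⟩
  (f ∗ shift 1 (shift a g)) n ≡⟨ ∗-shift1 f (shift a g) n ⟩
  shift 1 (f ∗ shift a g) n   ≡⟨ shift-cong 1 (∗-shift a f g) n ⟩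
  shift 1 (shift a (f ∗ g)) n ≡⟨ shift-suc a (f ∗ g) n ⟨
  shift (suc a) (f ∗ g) n     ∎
  where open ≡-Reasoning

∗-linearˡ : ∀ g → Linear (_∗ g)
∗-linearˡ g = record
  { ≗-cong    = λ e → ∗-cong {g = g} e (λ _ → refl)
  ; ⊕-hom     = λ f h n → trans (Σ<-cong (suc n) (λ {i} _ → ℤ.*-distribʳ-+ (g (n ∸ i)) (f i) (h i)))
                                (Σ<-+ (suc n) (λ i → f i *ᶻ g (n ∸ i)) (λ i → h i *ᶻ g (n ∸ i)))
  ; ⊙-hom     = λ c f n → trans (Σ<-cong (suc n) (λ {i} _ → ℤ.*-assoc c (f i) (g (n ∸ i))))
                                (Σ<-* (suc n) c (λ i → f i *ᶻ g (n ∸ i)))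
  ; shift-hom = λ s f → shift-∗ s f g
  }

∗-linearʳ : ∀ f → Linear (f ∗_)
∗-linearʳ f = record
  { ≗-cong    = λ e → ∗-cong {f = f} (λ _ → refl) e
  ; ⊕-hom     = λ g h n → trans (Σ<-cong (suc n) (λ {i} _ → ℤ.*-distribˡ-+ (f i) (g (n ∸ i)) (h (n ∸ i))))
                                (Σ<-+ (suc n) (λ i → f i *ᶻ g (n ∸ i)) (λ i → f i *ᶻ h (n ∸ i)))
  ; ⊙-hom     = λ c g n → trans (Σ<-cong (suc n) (λ {i} _ → left-commute c (f i) (g (n ∸ i))))
                                (Σ<-* (suc n) c (λ i → f i *ᶻ g (n ∸ i)))
  ; shift-hom = λ s g → ∗-shift s f g
  }
  where
  left-commute : ∀ c a b → a *ᶻ (c *ᶻ b) ≡ c *ᶻ (a *ᶻ b)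
  left-commute = solve-∀

[1-q^]-∗ : ∀ a f g → [1-q^ a ] f ∗ g ≗ f ∗ [1-q^ a ] g
[1-q^]-∗ a f g n =
  trans (linear-[1-q^] (∗-linearˡ g) a f n) (sym (linear-[1-q^] (∗-linearʳ f) a g n))

shift-𝟙-∗ : ∀ e g n → (shift e 𝟙 ∗ g) n ≡ shift e g n
shift-𝟙-∗ e g n = trans (shift-∗ e 𝟙 g n) (shift-cong e (𝟙-∗ g) n)

∗-mod : ∀ {f f′ g g′ n} → f ≡ f′ mod-q^ suc n → g ≡ g′ mod-q^ suc n → (f ∗ g) n ≡ (f′ ∗ g′) n
∗-mod {n = n} f≡f′ g≡g′ = Σ<-cong (suc n) (λ {i} i≤n → cong₂ _*ᶻ_ (f≡f′ i≤n) (g≡g′ (s≤s (ℕ.m∸n≤m n i))))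

-- Gaussian binomial coefficients

choose₂ : ℕ → ℕ
choose₂ zero    = 0
choose₂ (suc j) = choose₂ j +ℕ j

choose₂-+ : ∀ a b → choose₂ (a +ℕ b) ≡ choose₂ a +ℕ choose₂ b +ℕ a *ℕ b
choose₂-+ a zero    rewrite ℕ.+-identityʳ a | ℕ.*-zeroʳ a = sym (trans (ℕ.+-identityʳ _) (ℕ.+-identityʳ _))
choose₂-+ a (suc b) rewrite ℕ.+-suc a b | choose₂-+ a b = regroup (choose₂ a) (choose₂ b) a b
  where
  regroup : ∀ A B a b → A +ℕ B +ℕ a *ℕ b +ℕ (a +ℕ b) ≡ A +ℕ (B +ℕ b) +ℕ a *ℕ suc b
  regroup = solve-∀ℕ

choose₂-double : ∀ k → choose₂ k +ℕ choose₂ k +ℕ k ≡ k *ℕ k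
choose₂-double zero    = refl
choose₂-double (suc k) = begin
  choose₂ k +ℕ k +ℕ (choose₂ k +ℕ k) +ℕ suc k    ≡⟨ regroup (choose₂ k) k ⟩
  choose₂ k +ℕ choose₂ k +ℕ k +ℕ suc (k +ℕ k)     ≡⟨ cong (_+ℕ suc (k +ℕ k)) (choose₂-double k) ⟩
  k *ℕ k +ℕ suc (k +ℕ k)                          ≡⟨ square-suc k ⟩
  suc k *ℕ suc k                                  ∎
  where
  open ≡-Reasoning
  regroup : ∀ T k → T +ℕ k +ℕ (T +ℕ k) +ℕ suc k ≡ T +ℕ T +ℕ k +ℕ suc (k +ℕ k)
  regroup = solve-∀ℕ
  square-suc : ∀ k → k *ℕ k +ℕ suc (k +ℕ k) ≡ suc k *ℕ suc k
  square-suc = solve-∀ℕ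

module GaussianBinomial (m : ℕ) where

  -- the Gaussian binomial coefficient [n, j] in the variable q^m
  qbinom : ℕ → ℕ → Series
  qbinom zero    zero    = 𝟙
  qbinom zero    (suc j) = 𝟘
  qbinom (suc n) zero    = 𝟙
  qbinom (suc n) (suc j) = qbinom n (suc j) ⊕ shift ((n ∸ j) *ℕ m) (qbinom n j)

  qbinom-0 : ∀ n → qbinom n 0 ≗ 𝟙
  qbinom-0 zero    y = refl
  qbinom-0 (suc n) y = refl

  qbinom-above : ∀ {n j} → n < j → qbinom n j ≗ 𝟘
  qbinom-above {zero}  {suc j} _       y = refl
  qbinom-above {suc n} {suc j} (s≤s p) y =
    cong₂ _+ᶻ_ (qbinom-above (ℕ.m≤n⇒m≤1+n p) y) (shift-𝟘 ((n ∸ j) *ℕ m) (qbinom-above p) y)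

  shift-qbinom-above : ∀ e {n j} → n < j → shift e (qbinom n j) ≗ 𝟘
  shift-qbinom-above e n<j = shift-𝟘 e (qbinom-above n<j)

  -- ∏_{i<n} (q^{s m} - q^{1 + i m})
  binomialProduct : ℕ → ℕ → Series
  binomialProduct s zero    = 𝟙
  binomialProduct s (suc n) = shift (s *ℕ m) prev ⊝ shift (suc (n *ℕ m)) prev
    where prev = binomialProduct s n

  binomialExp : ℕ → ℕ → ℕ → ℕ
  binomialExp s n j = j +ℕ (choose₂ j +ℕ s *ℕ (n ∸ j)) *ℕ m

  binomialSum : ℕ → ℕ → Series
  binomialSum s n = Σ<ˢ (suc n) (λ j → sign j ⊙ shift (binomialExp s n j) (qbinom n j))

  binomialExp-suc : ∀ s {n j} → j ≤ n → s *ℕ m +ℕ binomialExp s n j ≡ binomialExp s (suc n) j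
  binomialExp-suc s {n} {j} j≤n
    rewrite sym (ℕ.m+[n∸m]≡n j≤n) | ℕ.m+n∸m≡n j (n ∸ j) | sym (ℕ.+-suc j (n ∸ j)) | ℕ.m+n∸m≡n j (suc (n ∸ j))
    = shuffle s m (choose₂ j) j (n ∸ j)
    where
    shuffle : ∀ s m T j d → s *ℕ m +ℕ (j +ℕ (T +ℕ s *ℕ d) *ℕ m) ≡ j +ℕ (T +ℕ s *ℕ suc d) *ℕ m
    shuffle = solve-∀ℕ

  binomialExp-pascal : ∀ s {n j} → j ≤ n →
    binomialExp s (suc n) (suc j) +ℕ (n ∸ j) *ℕ m ≡ suc (n *ℕ m) +ℕ binomialExp s n j
  binomialExp-pascal s {n} {j} j≤n
    rewrite sym (ℕ.m+[n∸m]≡n j≤n) | ℕ.m+n∸m≡n j (n ∸ j)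
    = shuffle s m (choose₂ j) j (n ∸ j)
    where
    shuffle : ∀ s m T j d → suc j +ℕ (T +ℕ j +ℕ s *ℕ d) *ℕ m +ℕ d *ℕ m ≡ suc ((j +ℕ d) *ℕ m) +ℕ (j +ℕ (T +ℕ s *ℕ d) *ℕ m)
    shuffle = solve-∀ℕ

  shift-binomialSum : ∀ a s n y →
    shift a (binomialSum s n) y ≡ Σ< (suc n) (λ j → sign j *ᶻ shift (a +ℕ binomialExp s n j) (qbinom n j) y)
  shift-binomialSum a s n y =
    trans (linear-Σ<ˢ (shift-linear a) (suc n) (λ j → sign j ⊙ shift (binomialExp s n j) (qbinom n j)) y)
          (Σ<-cong (suc n) λ {j} _ → trans (shift-⊙ a (sign j) _ y)
                                           (cong (sign j *ᶻ_) (shift-shift a (binomialExp s n j) (qbinom n j) y)))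

  binomialSum-suc : ∀ s n →
    shift (s *ℕ m) (binomialSum s n) ⊝ shift (suc (n *ℕ m)) (binomialSum s n) ≗ binomialSum s (suc n)
  binomialSum-suc s n y = begin
      shift (s *ℕ m) (binomialSum s n) y -ᶻ shift (suc (n *ℕ m)) (binomialSum s n) y
        ≡⟨ cong₂ _-ᶻ_ (shift-binomialSum (s *ℕ m) s n y) (shift-binomialSum (suc (n *ℕ m)) s n y) ⟩
      Σ< (suc n) U -ᶻ Σ< (suc n) V
        ≡⟨ cong (λ z → z -ᶻ Σ< (suc n) V) (Σ<-rotate (suc n) U U-last) ⟩
      (U 0 +ᶻ Σ< (suc n) (U ∘ suc)) -ᶻ Σ< (suc n) V
        ≡⟨ regroup (U 0) _ _ ⟩
      U 0 +ᶻ (Σ< (suc n) (U ∘ suc) +ᶻ -ᶻ Σ< (suc n) V)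
        ≡⟨ cong (λ z → U 0 +ᶻ (Σ< (suc n) (U ∘ suc) +ᶻ z)) (Σ<-neg (suc n) V) ⟨
      U 0 +ᶻ (Σ< (suc n) (U ∘ suc) +ᶻ Σ< (suc n) (λ j → -ᶻ V j))
        ≡⟨ cong (U 0 +ᶻ_) (Σ<-+ (suc n) (U ∘ suc) (λ j → -ᶻ V j)) ⟨
      U 0 +ᶻ Σ< (suc n) (λ j → U (suc j) +ᶻ -ᶻ V j)
        ≡⟨ cong₂ _+ᶻ_ U-first (Σ<-cong (suc n) (λ { (s≤s j≤n) → pascal-term j≤n })) ⟩
      binomialSum s (suc n) y ∎
    where
    open ≡-Reasoning
    U V : ℕ → ℤ
    U j = sign j *ᶻ shift (s *ℕ m +ℕ binomialExp s n j) (qbinom n j) y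
    V j = sign j *ᶻ shift (suc (n *ℕ m) +ℕ binomialExp s n j) (qbinom n j) y
    W : ℕ → ℤ
    W j = sign j *ᶻ shift (binomialExp s (suc n) j) (qbinom (suc n) j) y

    regroup : ∀ a b c → (a +ᶻ b) -ᶻ c ≡ a +ᶻ (b +ᶻ -ᶻ c)
    regroup = solve-∀

    U-last : U (suc n) ≡ 0ℤ
    U-last = trans (cong (sign (suc n) *ᶻ_) (shift-qbinom-above (s *ℕ m +ℕ binomialExp s n (suc n)) (ℕ.n<1+n n) y)) (ℤ.*-zeroʳ (sign (suc n)))

    U-first : U 0 ≡ W 0
    U-first = cong (sign 0 *ᶻ_)
      (trans (cong (λ e → shift e (qbinom n 0) y) (binomialExp-suc s z≤n))
             (shift-cong (binomialExp s (suc n) 0) (qbinom-0 n) y))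

    upper : ∀ {j} → j ≤ n →
      shift (binomialExp s (suc n) (suc j)) (qbinom n (suc j)) y ≡ shift (s *ℕ m +ℕ binomialExp s n (suc j)) (qbinom n (suc j)) y
    upper {j} j≤n with ℕ.m≤n⇒m<n∨m≡n j≤n
    ... | inj₁ j<n  = cong (λ e → shift e (qbinom n (suc j)) y) (sym (binomialExp-suc s j<n))
    ... | inj₂ refl = trans (shift-qbinom-above (binomialExp s (suc j) (suc j)) (ℕ.n<1+n j) y)
                            (sym (shift-qbinom-above (s *ℕ m +ℕ binomialExp s j (suc j)) (ℕ.n<1+n j) y))

    pascal-term : ∀ {j} → j ≤ n → U (suc j) +ᶻ -ᶻ V j ≡ W (suc j)
    pascal-term {j} j≤n = sym (begin
        sign (suc j) *ᶻ shift e (qbinom n (suc j) ⊕ shift d (qbinom n j)) y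
          ≡⟨ cong (sign (suc j) *ᶻ_) (trans (shift-⊕ e _ _ y) (cong (shift e (qbinom n (suc j)) y +ᶻ_) (shift-shift e d _ y))) ⟩
        sign (suc j) *ᶻ (shift e (qbinom n (suc j)) y +ᶻ shift (e +ℕ d) (qbinom n j) y)
          ≡⟨ ℤ.*-distribˡ-+ (sign (suc j)) _ _ ⟩
        sign (suc j) *ᶻ shift e (qbinom n (suc j)) y +ᶻ sign (suc j) *ᶻ shift (e +ℕ d) (qbinom n j) y
          ≡⟨ cong₂ _+ᶻ_ (cong (sign (suc j) *ᶻ_) (upper j≤n))
                        (trans (sign-suc j _) (cong (λ z → -ᶻ (sign j *ᶻ shift z (qbinom n j) y)) (binomialExp-pascal s j≤n))) ⟩
        U (suc j) +ᶻ -ᶻ V j ∎)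
      where
      e = binomialExp s (suc n) (suc j)
      d = (n ∸ j) *ℕ m

  q-binomial : ∀ s n → binomialProduct s n ≗ binomialSum s n
  q-binomial s zero    y rewrite ℕ.*-zeroʳ s = sym (trans (ℤ.+-identityʳ _) (ℤ.*-identityˡ (𝟙 y)))
  q-binomial s (suc n) y = trans
    (cong₂ _-ᶻ_ (shift-cong (s *ℕ m) (q-binomial s n) y) (shift-cong (suc (n *ℕ m)) (q-binomial s n) y))
    (binomialSum-suc s n y)

  multiples : ℕ → List ℕ
  multiples zero    = []
  multiples (suc N) = suc N *ℕ m ∷ multiples N

  -- multiplication by (q^m; q^m)_N
  qPoch : ℕ → Series → Series
  qPoch N = ∏[1-q^_]_ (multiples N)

  qPoch-linear : ∀ N → Linear (qPoch N)
  qPoch-linear N = ∏[1-q^]-linear (multiples N)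

  qbinom-qPoch : ∀ {n j} → j ≤ n → qPoch j (qPoch (n ∸ j) (qbinom n j)) ≗ qPoch n 𝟙
  qbinom-qPoch {zero}  {zero}  _         y = refl
  qbinom-qPoch {suc n} {zero}  _         y = refl
  qbinom-qPoch {suc n} {suc j} (s≤s j≤n) y with ℕ.m≤n⇒m<n∨m≡n j≤n
  ... | inj₂ refl rewrite ℕ.n∸n≡0 j = begin
      qPoch (suc j) (qbinom j (suc j) ⊕ qbinom j j) y
        ≡⟨ ≗-cong (qPoch-linear (suc j)) (λ z → trans (cong (_+ᶻ qbinom j j z) (qbinom-above (ℕ.n<1+n j) z))
                                                      (ℤ.+-identityˡ (qbinom j j z))) y ⟩
      qPoch (suc j) (qbinom j j) y
        ≡⟨ [1-q^]-cong (suc j *ℕ m) (subst (λ d → qPoch j (qPoch d (qbinom j j)) ≗ qPoch j 𝟙) (ℕ.n∸n≡0 j) (qbinom-qPoch {j} ℕ.≤-refl)) y ⟩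
      qPoch (suc j) 𝟙 y ∎
    where open ≡-Reasoning
  ... | inj₁ j<n rewrite ℕ.+-∸-assoc 1 j<n = begin
      qPoch (suc j) ([1-q^ a ] qPoch b (qbinom n (suc j) ⊕ shift a (qbinom n j))) y
        ≡⟨ ⊕-hom (∘-linear (qPoch-linear (suc j)) (qPoch-linear (suc b))) (qbinom n (suc j)) (shift a (qbinom n j)) y ⟩
      qPoch (suc j) ([1-q^ a ] qPoch b (qbinom n (suc j))) y +ᶻ qPoch (suc j) (qPoch (suc b) (shift a (qbinom n j))) y
        ≡⟨ cong₂ _+ᶻ_ upper lower ⟩
      ([1-q^ a ] qPoch n 𝟙 ⊕ [1-q^ c ] shift a (qPoch n 𝟙)) y
        ≡⟨ [1-q^]-telescope a c (qPoch n 𝟙) y ⟩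
      ([1-q^ c +ℕ a ] qPoch n 𝟙) y
        ≡⟨ cong (λ e → ([1-q^ e ] qPoch n 𝟙) y) c+a≡ ⟩
      qPoch (suc n) 𝟙 y ∎
    where
    open ≡-Reasoning
    b = n ∸ suc j
    a = suc b *ℕ m
    c = suc j *ℕ m
    upper : qPoch (suc j) ([1-q^ a ] qPoch b (qbinom n (suc j))) y ≡ ([1-q^ a ] qPoch n 𝟙) y
    upper = trans (sym (linear-∏[1-q^] ([1-q^]-linear a) (multiples (suc j)) (qPoch b (qbinom n (suc j))) y))
                  ([1-q^]-cong a (qbinom-qPoch j<n) y)
    lower : qPoch (suc j) (qPoch (suc b) (shift a (qbinom n j))) y ≡ ([1-q^ c ] shift a (qPoch n 𝟙)) y
    lower = [1-q^]-cong c (λ z →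
      trans (shift-hom (∘-linear (qPoch-linear j) (qPoch-linear (suc b))) a (qbinom n j) z)
            (shift-cong a (subst (λ d → qPoch j (qPoch d (qbinom n j)) ≗ qPoch n 𝟙) (ℕ.+-∸-assoc 1 j<n) (qbinom-qPoch j≤n)) z)) y
    c+a≡ : c +ℕ a ≡ suc n *ℕ m
    c+a≡ = trans (sym (ℕ.*-distribʳ-+ m (suc j) (suc b))) (cong (_*ℕ m) (trans (ℕ.+-suc (suc j) b) (cong suc (ℕ.m+[n∸m]≡n j<n))))

-- The Jacobi triple product, truncated

module JacobiTripleProduct (m′ : ℕ) where

  m : ℕ
  m = suc m′

  open GaussianBinomial m public

  oneAboveMultiples : ℕ → List ℕ
  oneAboveMultiples zero    = []
  oneAboveMultiples (suc r) = suc (r *ℕ m) ∷ oneAboveMultiples r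

  oneBelowMultiples : ℕ → ℕ → List ℕ
  oneBelowMultiples N zero    = []
  oneBelowMultiples N (suc n) = N *ℕ m ∸ suc (n *ℕ m) ∷ oneBelowMultiples N n

  jacobiProduct : ℕ → Series
  jacobiProduct N = ∏[1-q^ oneAboveMultiples N ] ∏[1-q^ oneBelowMultiples N N ] 𝟙

  -- for n ≤ N, each factor q^{N m} - q^{1 + i m} is -q^{1 + i m} (1 - q^{N m - 1 - i m})
  binomialProduct-below : ∀ {N n} → n ≤ N →
    binomialProduct N n ≗ sign n ⊙ shift (n +ℕ choose₂ n *ℕ m) (∏[1-q^ oneBelowMultiples N n ] 𝟙)
  binomialProduct-below {N} {zero}  _   y = sym (ℤ.*-identityˡ (𝟙 y))
  binomialProduct-below {N} {suc n} n<N y = begin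
      shift (N *ℕ m) prev y -ᶻ shift a prev y
        ≡⟨ cong (λ z → shift z prev y -ᶻ shift a prev y) (sym (ℕ.m+[n∸m]≡n a≤Nm)) ⟩
      shift (a +ℕ c) prev y -ᶻ shift a prev y
        ≡⟨ flip (shift a prev y) (shift (a +ℕ c) prev y) ⟩
      -ᶻ (shift a prev y -ᶻ shift (a +ℕ c) prev y)
        ≡⟨ cong -ᶻ_ (shift-[1-q^] a c prev y) ⟨
      -ᶻ shift a ([1-q^ c ] prev) y
        ≡⟨ cong -ᶻ_ (shift-cong a ([1-q^]-cong c (binomialProduct-below (ℕ.<⇒≤ n<N))) y) ⟩
      -ᶻ shift a ([1-q^ c ] (sign n ⊙ shift e F)) y
        ≡⟨ cong -ᶻ_ (shift-cong a ([1-q^]-⊙-shift c (sign n) e F) y) ⟩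
      -ᶻ shift a (sign n ⊙ shift e ([1-q^ c ] F)) y
        ≡⟨ cong -ᶻ_ (shift-⊙-shift a (sign n) e ([1-q^ c ] F) y) ⟩
      -ᶻ (sign n *ᶻ shift (a +ℕ e) ([1-q^ c ] F) y)
        ≡⟨ sign-suc n _ ⟨
      sign (suc n) *ᶻ shift (a +ℕ e) ([1-q^ c ] F) y
        ≡⟨ cong (λ z → sign (suc n) *ᶻ shift z ([1-q^ c ] F) y) (exponent n (choose₂ n) m) ⟩
      sign (suc n) *ᶻ shift (suc n +ℕ choose₂ (suc n) *ℕ m) ([1-q^ c ] F) y ∎
    where
    open ≡-Reasoning
    prev = binomialProduct N n
    F = ∏[1-q^ oneBelowMultiples N n ] 𝟙
    a = suc (n *ℕ m)
    c = N *ℕ m ∸ a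
    e = n +ℕ choose₂ n *ℕ m
    a≤Nm : a ≤ N *ℕ m
    a≤Nm = ℕ.≤-trans (s≤s (ℕ.m≤n+m (n *ℕ m) m′)) (ℕ.*-monoˡ-≤ m n<N)
    flip : ∀ u v → v -ᶻ u ≡ -ᶻ (u -ᶻ v)
    flip = solve-∀
    exponent : ∀ n T m → suc (n *ℕ m) +ℕ (n +ℕ T *ℕ m) ≡ suc n +ℕ (T +ℕ n) *ℕ m
    exponent = solve-∀ℕ

  -- beyond n = N, each factor q^{N m} - q^{1 + (N + i) m} is q^{N m} (1 - q^{1 + i m})
  binomialProduct-above : ∀ N r →
    binomialProduct N (N +ℕ r) ≗
      sign N ⊙ shift (N +ℕ choose₂ N *ℕ m +ℕ r *ℕ (N *ℕ m)) (∏[1-q^ oneAboveMultiples r ] ∏[1-q^ oneBelowMultiples N N ] 𝟙)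
  binomialProduct-above N zero y rewrite ℕ.+-identityʳ N | ℕ.+-identityʳ (N +ℕ choose₂ N *ℕ m) =
    binomialProduct-below {N} ℕ.≤-refl y
  binomialProduct-above N (suc r) y rewrite ℕ.+-suc N r = begin
      shift a prev y -ᶻ shift (suc ((N +ℕ r) *ℕ m)) prev y
        ≡⟨ cong (λ z → shift a prev y -ᶻ shift z prev y) (split N r m) ⟩
      shift a prev y -ᶻ shift (a +ℕ b) prev y
        ≡⟨ shift-[1-q^] a b prev y ⟨
      shift a ([1-q^ b ] prev) y
        ≡⟨ shift-cong a ([1-q^]-cong b (binomialProduct-above N r)) y ⟩
      shift a ([1-q^ b ] (sign N ⊙ shift e F)) y
        ≡⟨ shift-cong a ([1-q^]-⊙-shift b (sign N) e F) y ⟩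
      shift a (sign N ⊙ shift e ([1-q^ b ] F)) y
        ≡⟨ shift-⊙-shift a (sign N) e ([1-q^ b ] F) y ⟩
      sign N *ᶻ shift (a +ℕ e) ([1-q^ b ] F) y
        ≡⟨ cong (λ z → sign N *ᶻ shift z ([1-q^ b ] F) y) (swap a (N +ℕ choose₂ N *ℕ m) (r *ℕ a)) ⟩
      sign N *ᶻ shift (N +ℕ choose₂ N *ℕ m +ℕ suc r *ℕ a) ([1-q^ b ] F) y ∎
    where
    open ≡-Reasoning
    prev = binomialProduct N (N +ℕ r)
    F = ∏[1-q^ oneAboveMultiples r ] ∏[1-q^ oneBelowMultiples N N ] 𝟙
    a = N *ℕ m
    b = suc (r *ℕ m)
    e = N +ℕ choose₂ N *ℕ m +ℕ r *ℕ a
    split : ∀ N r m → suc ((N +ℕ r) *ℕ m) ≡ N *ℕ m +ℕ suc (r *ℕ m)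
    split = solve-∀ℕ
    swap : ∀ a c d → a +ℕ (c +ℕ d) ≡ c +ℕ (a +ℕ d)
    swap = solve-∀ℕ

  jacobiExp : ℕ → ℕ
  jacobiExp N = N +ℕ choose₂ N *ℕ m +ℕ N *ℕ (N *ℕ m)

  binomialProduct-jacobi : ∀ N → binomialProduct N (N +ℕ N) ≗ sign N ⊙ shift (jacobiExp N) (jacobiProduct N)
  binomialProduct-jacobi N = binomialProduct-above N N

  pentagonalP pentagonalQ : ℕ → ℕ
  pentagonalP k = k +ℕ choose₂ k *ℕ m
  pentagonalQ k = k *ℕ m′ +ℕ choose₂ k *ℕ m

  binomialExp-right : ∀ {N k} → k ≤ N → binomialExp N (N +ℕ N) (N +ℕ k) ≡ jacobiExp N +ℕ pentagonalP k
  binomialExp-right {N} {k} k≤N rewrite sym (ℕ.m+[n∸m]≡n k≤N) = at (N ∸ k)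
    where
    at : ∀ d → binomialExp (k +ℕ d) ((k +ℕ d) +ℕ (k +ℕ d)) ((k +ℕ d) +ℕ k) ≡ jacobiExp (k +ℕ d) +ℕ pentagonalP k
    at d rewrite ℕ.[m+n]∸[m+o]≡n∸o (k +ℕ d) (k +ℕ d) k | ℕ.m+n∸m≡n k d | choose₂-+ (k +ℕ d) k
      = expand k d (choose₂ (k +ℕ d)) (choose₂ k) m
      where
      expand : ∀ k d A T m → (k +ℕ d) +ℕ k +ℕ (A +ℕ T +ℕ (k +ℕ d) *ℕ k +ℕ (k +ℕ d) *ℕ d) *ℕ m
                           ≡ (k +ℕ d) +ℕ A *ℕ m +ℕ (k +ℕ d) *ℕ ((k +ℕ d) *ℕ m) +ℕ (k +ℕ T *ℕ m)
      expand = solve-∀ℕ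

  double-∸ : ∀ k d → (k +ℕ d) +ℕ (k +ℕ d) ∸ d ≡ k +ℕ (k +ℕ d)
  double-∸ k d = trans (cong (_∸ d) (reassoc k d)) (ℕ.m+n∸n≡m (k +ℕ (k +ℕ d)) d)
    where
    reassoc : ∀ k d → (k +ℕ d) +ℕ (k +ℕ d) ≡ (k +ℕ (k +ℕ d)) +ℕ d
    reassoc = solve-∀ℕ

  binomialExp-left : ∀ {N k} → k ≤ N → binomialExp N (N +ℕ N) (N ∸ k) ≡ jacobiExp N +ℕ pentagonalQ k
  binomialExp-left {N} {k} k≤N rewrite sym (ℕ.m+[n∸m]≡n k≤N) = at (N ∸ k)
    where
    at : ∀ d → binomialExp (k +ℕ d) ((k +ℕ d) +ℕ (k +ℕ d)) ((k +ℕ d) ∸ k) ≡ jacobiExp (k +ℕ d) +ℕ pentagonalQ k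
    at d rewrite ℕ.m+n∸m≡n k d | double-∸ k d | choose₂-+ k d = begin
        d +ℕ (choose₂ d +ℕ (k +ℕ d) *ℕ (k +ℕ (k +ℕ d))) *ℕ m
          ≡⟨ expand k d (choose₂ d) m ⟩
        d +ℕ (choose₂ d +ℕ 3 *ℕ (k *ℕ d) +ℕ d *ℕ d +ℕ k *ℕ k) *ℕ m +ℕ (k *ℕ k) *ℕ m
          ≡⟨ cong (λ z → d +ℕ (choose₂ d +ℕ 3 *ℕ (k *ℕ d) +ℕ d *ℕ d +ℕ k *ℕ k) *ℕ m +ℕ z *ℕ m) (sym (choose₂-double k)) ⟩
        d +ℕ (choose₂ d +ℕ 3 *ℕ (k *ℕ d) +ℕ d *ℕ d +ℕ k *ℕ k) *ℕ m +ℕ (choose₂ k +ℕ choose₂ k +ℕ k) *ℕ m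
          ≡⟨ regroup k d (choose₂ k) (choose₂ d) m′ ⟩
        (k +ℕ d) +ℕ (choose₂ k +ℕ choose₂ d +ℕ k *ℕ d) *ℕ m +ℕ (k +ℕ d) *ℕ ((k +ℕ d) *ℕ m) +ℕ (k *ℕ m′ +ℕ choose₂ k *ℕ m) ∎
      where
      open ≡-Reasoning
      expand : ∀ k d U m → d +ℕ (U +ℕ (k +ℕ d) *ℕ (k +ℕ (k +ℕ d))) *ℕ m
                         ≡ d +ℕ (U +ℕ 3 *ℕ (k *ℕ d) +ℕ d *ℕ d +ℕ k *ℕ k) *ℕ m +ℕ (k *ℕ k) *ℕ m
      expand = solve-∀ℕ
      regroup : ∀ k d T U m′ → d +ℕ (U +ℕ 3 *ℕ (k *ℕ d) +ℕ d *ℕ d +ℕ k *ℕ k) *ℕ suc m′ +ℕ (T +ℕ T +ℕ k) *ℕ suc m′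
                             ≡ (k +ℕ d) +ℕ (T +ℕ U +ℕ k *ℕ d) *ℕ suc m′ +ℕ (k +ℕ d) *ℕ ((k +ℕ d) *ℕ suc m′) +ℕ (k *ℕ m′ +ℕ T *ℕ suc m′)
      regroup = solve-∀ℕ

  binomialExp-centre : ∀ N → binomialExp N (N +ℕ N) N ≡ jacobiExp N +ℕ 0
  binomialExp-centre N = subst (λ j → binomialExp N (N +ℕ N) j ≡ jacobiExp N +ℕ 0) (ℕ.+-identityʳ N) (binomialExp-right {N} z≤n)

  jacobiTerm : ℕ → ℕ → Series
  jacobiTerm N k = sign k ⊙ (shift (pentagonalP k) (qbinom (N +ℕ N) (N +ℕ k)) ⊕ shift (pentagonalQ k) (qbinom (N +ℕ N) (N ∸ k)))

  jacobiSum : ℕ → Series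
  jacobiSum N = qbinom (N +ℕ N) N ⊕ sumFrom1ˢ N (jacobiTerm N)

  -- the q-binomial theorem for ∏_{i<2N} (q^{N m} - q^{1 + i m}), read around its middle term j = N
  jacobiProduct-sum : ∀ N → jacobiProduct N ≗ jacobiSum N
  jacobiProduct-sum N y = begin
      jacobiProduct N y
        ≡⟨ sign-cancel N (jacobiProduct N y) ⟨
      sign N *ᶻ (sign N *ᶻ jacobiProduct N y)
        ≡⟨ cong (λ z → sign N *ᶻ (sign N *ᶻ z)) (shift-+ J (jacobiProduct N) y) ⟨
      sign N *ᶻ (sign N *ᶻ shift J (jacobiProduct N) (J +ℕ y))
        ≡⟨ cong (sign N *ᶻ_) (binomialProduct-jacobi N (J +ℕ y)) ⟨
      sign N *ᶻ binomialProduct N (N +ℕ N) (J +ℕ y)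
        ≡⟨ cong (sign N *ᶻ_) (q-binomial N (N +ℕ N) (J +ℕ y)) ⟩
      sign N *ᶻ Σ< (suc (N +ℕ N)) g
        ≡⟨ cong (sign N *ᶻ_) (Σ<-around-middle N g) ⟩
      sign N *ᶻ (g N +ᶻ sumFrom1 N (λ k → g (N +ℕ k) +ᶻ g (N ∸ k)))
        ≡⟨ ℤ.*-distribˡ-+ (sign N) _ _ ⟩
      sign N *ᶻ g N +ᶻ sign N *ᶻ sumFrom1 N (λ k → g (N +ℕ k) +ᶻ g (N ∸ k))
        ≡⟨ cong₂ _+ᶻ_ centre (sym (sumFrom1-* N (sign N) _)) ⟩
      qbinom (N +ℕ N) N y +ᶻ sumFrom1 N (λ k → sign N *ᶻ (g (N +ℕ k) +ᶻ g (N ∸ k)))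
        ≡⟨ cong (qbinom (N +ℕ N) N y +ᶻ_) (sumFrom1-cong N (λ _ → pair)) ⟩
      jacobiSum N y ∎
    where
    open ≡-Reasoning
    J = jacobiExp N
    g : ℕ → ℤ
    g j = sign j *ᶻ shift (binomialExp N (N +ℕ N) j) (qbinom (N +ℕ N) j) (J +ℕ y)
    recentre : ∀ {j} e → binomialExp N (N +ℕ N) j ≡ J +ℕ e →
      shift (binomialExp N (N +ℕ N) j) (qbinom (N +ℕ N) j) (J +ℕ y) ≡ shift e (qbinom (N +ℕ N) j) y
    recentre {j} e eq = trans (cong (λ z → shift z (qbinom (N +ℕ N) j) (J +ℕ y)) eq) (shift-+-+ J e _ y)
    centre : sign N *ᶻ g N ≡ qbinom (N +ℕ N) N y
    centre = trans (sign-cancel N _) (recentre 0 (binomialExp-centre N))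
    distrib : ∀ s a b p q → s *ᶻ (a *ᶻ p +ᶻ b *ᶻ q) ≡ (s *ᶻ a) *ᶻ p +ᶻ (s *ᶻ b) *ᶻ q
    distrib = solve-∀
    pair : ∀ {k} → k ≤ N → sign N *ᶻ (g (N +ℕ k) +ᶻ g (N ∸ k)) ≡ jacobiTerm N k y
    pair {k} k≤N = begin
      sign N *ᶻ (g (N +ℕ k) +ᶻ g (N ∸ k))
        ≡⟨ distrib (sign N) (sign (N +ℕ k)) (sign (N ∸ k)) _ _ ⟩
      (sign N *ᶻ sign (N +ℕ k)) *ᶻ _ +ᶻ (sign N *ᶻ sign (N ∸ k)) *ᶻ _
        ≡⟨ cong₂ _+ᶻ_ (cong₂ _*ᶻ_ (sign-+-cancel N k) (recentre (pentagonalP k) (binomialExp-right k≤N)))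
                      (cong₂ _*ᶻ_ (sign-∸-cancel N k k≤N) (recentre (pentagonalQ k) (binomialExp-left k≤N))) ⟩
      sign k *ᶻ _ +ᶻ sign k *ᶻ _
        ≡⟨ ℤ.*-distribˡ-+ (sign k) _ _ ⟨
      jacobiTerm N k y ∎

  multiplesFrom : ℕ → ℕ → List ℕ
  multiplesFrom lo zero    = []
  multiplesFrom lo (suc e) = (lo +ℕ suc e) *ℕ m ∷ multiplesFrom lo e

  multiples-+ : ∀ c e → multiples (c +ℕ e) ≡ multiplesFrom c e ++ multiples c
  multiples-+ c zero    rewrite ℕ.+-identityʳ c = refl
  multiples-+ c (suc e) rewrite ℕ.+-suc c e = cong (suc (c +ℕ e) *ℕ m ∷_) (multiples-+ c e)

  qPoch-+ : ∀ c e f → qPoch (c +ℕ e) f ≡ ∏[1-q^ multiplesFrom c e ] qPoch c f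
  qPoch-+ c e f = trans (cong (λ as → ∏[1-q^ as ] f) (multiples-+ c e)) (∏[1-q^]-++ (multiplesFrom c e) (multiples c) f)

  multiplesFrom-≥ : ∀ lo e {M} → M ≤ suc lo *ℕ m → All (M ≤_) (multiplesFrom lo e)
  multiplesFrom-≥ lo zero    M≤ = []
  multiplesFrom-≥ lo (suc e) M≤ =
    ℕ.≤-trans M≤ (ℕ.*-monoˡ-≤ m (ℕ.≤-trans (s≤s (ℕ.m≤m+n lo e)) (ℕ.≤-reflexive (sym (ℕ.+-suc lo e)))))
      ∷ multiplesFrom-≥ lo e M≤

  multiples-positive : ∀ d → All (1 ≤_) (multiples d)
  multiples-positive zero    = []
  multiples-positive (suc d) = s≤s z≤n ∷ multiples-positive d

  -- (q^m;q^m)_d (q^m;q^m)_c X = (q^m;q^m)_{d+c} forces X (q^m;q^m)_c = (q^{(d+1)m};q^m)_c,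
  -- all of whose factors are 1 modulo q^{(c+1)m}
  qPoch-≡𝟙 : ∀ {c d} N → c ≤ d → c ≤ N → ∀ X →
    qPoch d (qPoch c X) ≗ qPoch (d +ℕ c) 𝟙 → qPoch N X ≡ 𝟙 mod-q^ (suc c *ℕ m)
  qPoch-≡𝟙 {c} {d} N c≤d c≤N X e {y} y< = begin
      qPoch N X y
        ≡⟨ cong (λ n → qPoch n X y) (ℕ.m+[n∸m]≡n c≤N) ⟨
      qPoch (c +ℕ (N ∸ c)) X y
        ≡⟨ cong (λ f → f y) (qPoch-+ c (N ∸ c) X) ⟩
      (∏[1-q^ multiplesFrom c (N ∸ c) ] qPoch c X) y
        ≡⟨ ≗-cong (∏[1-q^]-linear (multiplesFrom c (N ∸ c))) X-value y ⟩
      (∏[1-q^ multiplesFrom c (N ∸ c) ] ∏[1-q^ multiplesFrom d c ] 𝟙) y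
        ≡⟨ ∏[1-q^]-mod (multiplesFrom-≥ c (N ∸ c) ℕ.≤-refl) _ y< ⟩
      (∏[1-q^ multiplesFrom d c ] 𝟙) y
        ≡⟨ ∏[1-q^]-mod (multiplesFrom-≥ d c (ℕ.*-monoˡ-≤ m (s≤s c≤d))) 𝟙 y< ⟩
      𝟙 y ∎
    where
    open ≡-Reasoning
    X-value : qPoch c X ≗ ∏[1-q^ multiplesFrom d c ] 𝟙
    X-value = ∏[1-q^]-injective (multiples-positive d) λ x →
      trans (e x) (trans (cong (λ f → f x) (qPoch-+ d c 𝟙)) (sym (linear-∏[1-q^] (qPoch-linear d) (multiplesFrom d c) 𝟙 x)))

  qPoch-comm : ∀ a b f → qPoch a (qPoch b f) ≗ qPoch b (qPoch a f)
  qPoch-comm a b f = linear-∏[1-q^] (qPoch-linear a) (multiples b) f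

  split-double : ∀ {N k} → k ≤ N → (N +ℕ k) +ℕ (N ∸ k) ≡ N +ℕ N
  split-double {N} {k} k≤N = trans (ℕ.+-assoc N k (N ∸ k)) (cong (N +ℕ_) (ℕ.m+[n∸m]≡n k≤N))

  qPoch-qbinom-right : ∀ {N k} → k ≤ N → qPoch N (qbinom (N +ℕ N) (N +ℕ k)) ≡ 𝟙 mod-q^ (suc (N ∸ k) *ℕ m)
  qPoch-qbinom-right {N} {k} k≤N =
    qPoch-≡𝟙 N (ℕ.≤-trans (ℕ.m∸n≤m N k) (ℕ.m≤m+n N k)) (ℕ.m∸n≤m N k) _ λ y → begin
      qPoch (N +ℕ k) (qPoch (N ∸ k) B) y
        ≡⟨ cong (λ d → qPoch (N +ℕ k) (qPoch d B) y) (ℕ.[m+n]∸[m+o]≡n∸o N N k) ⟨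
      qPoch (N +ℕ k) (qPoch ((N +ℕ N) ∸ (N +ℕ k)) B) y
        ≡⟨ qbinom-qPoch (ℕ.+-monoʳ-≤ N k≤N) y ⟩
      qPoch (N +ℕ N) 𝟙 y
        ≡⟨ cong (λ n → qPoch n 𝟙 y) (split-double k≤N) ⟨
      qPoch ((N +ℕ k) +ℕ (N ∸ k)) 𝟙 y ∎
    where
    open ≡-Reasoning
    B = qbinom (N +ℕ N) (N +ℕ k)

  qPoch-qbinom-left : ∀ {N k} → k ≤ N → qPoch N (qbinom (N +ℕ N) (N ∸ k)) ≡ 𝟙 mod-q^ (suc (N ∸ k) *ℕ m)
  qPoch-qbinom-left {N} {k} k≤N =
    qPoch-≡𝟙 N (ℕ.≤-trans (ℕ.m∸n≤m N k) (ℕ.m≤m+n N k)) (ℕ.m∸n≤m N k) _ λ y → begin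
      qPoch (N +ℕ k) (qPoch (N ∸ k) B) y
        ≡⟨ qPoch-comm (N +ℕ k) (N ∸ k) B y ⟩
      qPoch (N ∸ k) (qPoch (N +ℕ k) B) y
        ≡⟨ cong (λ d → qPoch (N ∸ k) (qPoch d B) y) complement ⟨
      qPoch (N ∸ k) (qPoch ((N +ℕ N) ∸ (N ∸ k)) B) y
        ≡⟨ qbinom-qPoch (ℕ.≤-trans (ℕ.m∸n≤m N k) (ℕ.m≤m+n N N)) y ⟩
      qPoch (N +ℕ N) 𝟙 y
        ≡⟨ cong (λ n → qPoch n 𝟙 y) (split-double k≤N) ⟨
      qPoch ((N +ℕ k) +ℕ (N ∸ k)) 𝟙 y ∎
    where
    open ≡-Reasoning
    B = qbinom (N +ℕ N) (N ∸ k)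
    complement : (N +ℕ N) ∸ (N ∸ k) ≡ N +ℕ k
    complement = trans (cong (_∸ (N ∸ k)) (sym (split-double k≤N))) (ℕ.m+n∸n≡m (N +ℕ k) (N ∸ k))

  pentagonalTerm : ℕ → Series
  pentagonalTerm k = sign k ⊙ (shift (pentagonalP k) 𝟙 ⊕ shift (pentagonalQ k) 𝟙)

  pentagonalSum : ℕ → Series
  pentagonalSum N = 𝟙 ⊕ sumFrom1ˢ N pentagonalTerm

  k≤pentagonalP : ∀ k → k ≤ pentagonalP k
  k≤pentagonalP k = ℕ.m≤m+n k (choose₂ k *ℕ m)

  k≤pentagonalQ : 1 ≤ m′ → ∀ k → k ≤ pentagonalQ k
  k≤pentagonalQ 1≤m′ k = ℕ.≤-trans (ℕ.m≤m*n k m′) (ℕ.m≤m+n (k *ℕ m′) (choose₂ k *ℕ m))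
    where instance _ = >-nonZero 1≤m′

  precision-bound : ∀ {y N k e} → y ≤ N → k ≤ e → k ≤ N → y < e +ℕ suc (N ∸ k) *ℕ m
  precision-bound {y} {N} {k} {e} y≤N k≤e k≤N = begin-strict
    y                        ≤⟨ y≤N ⟩
    N                        ≡⟨ ℕ.m+[n∸m]≡n k≤N ⟨
    k +ℕ (N ∸ k)             <⟨ ℕ.+-monoʳ-< k (ℕ.n<1+n (N ∸ k)) ⟩
    k +ℕ suc (N ∸ k)         ≤⟨ ℕ.+-mono-≤ k≤e (ℕ.m≤m*n (suc (N ∸ k)) m) ⟩
    e +ℕ suc (N ∸ k) *ℕ m    ∎
    where open ℕ.≤-Reasoning

  qPoch-jacobiSum : 1 ≤ m′ → ∀ N → qPoch N (jacobiSum N) ≡ pentagonalSum N mod-q^ (suc N)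
  qPoch-jacobiSum 1≤m′ N {y} (s≤s y≤N) = begin
      qPoch N (jacobiSum N) y
        ≡⟨ ⊕-hom (qPoch-linear N) _ _ y ⟩
      qPoch N (qbinom (N +ℕ N) N) y +ᶻ qPoch N (sumFrom1ˢ N (jacobiTerm N)) y
        ≡⟨ cong₂ _+ᶻ_ centre (linear-sumFrom1ˢ (qPoch-linear N) N (jacobiTerm N) y) ⟩
      𝟙 y +ᶻ sumFrom1 N (λ k → qPoch N (jacobiTerm N k) y)
        ≡⟨ cong (𝟙 y +ᶻ_) (sumFrom1-cong N (λ _ → termwise)) ⟩
      pentagonalSum N y ∎
    where
    open ≡-Reasoning
    centre : qPoch N (qbinom (N +ℕ N) N) y ≡ 𝟙 y
    centre = subst (λ j → qPoch N (qbinom (N +ℕ N) j) ≡ 𝟙 mod-q^ (suc N *ℕ m)) (ℕ.+-identityʳ N)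
                   (qPoch-qbinom-right {N} z≤n) (ℕ.≤-trans (s≤s y≤N) (ℕ.m≤m*n (suc N) m))
    termwise : ∀ {k} → k ≤ N → qPoch N (jacobiTerm N k) y ≡ pentagonalTerm k y
    termwise {k} k≤N = begin
      qPoch N (jacobiTerm N k) y
        ≡⟨ ⊙-hom (qPoch-linear N) (sign k) _ y ⟩
      sign k *ᶻ qPoch N (shift eP (qbinom (N +ℕ N) (N +ℕ k)) ⊕ shift eQ (qbinom (N +ℕ N) (N ∸ k))) y
        ≡⟨ cong (sign k *ᶻ_) (⊕-hom (qPoch-linear N) _ _ y) ⟩
      sign k *ᶻ (qPoch N (shift eP (qbinom (N +ℕ N) (N +ℕ k))) y +ᶻ qPoch N (shift eQ (qbinom (N +ℕ N) (N ∸ k))) y)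
        ≡⟨ cong (sign k *ᶻ_) (cong₂ _+ᶻ_
             (trans (shift-hom (qPoch-linear N) eP _ y) (shift-mod eP (qPoch-qbinom-right k≤N) (precision-bound y≤N (k≤pentagonalP k) k≤N)))
             (trans (shift-hom (qPoch-linear N) eQ _ y) (shift-mod eQ (qPoch-qbinom-left k≤N) (precision-bound y≤N (k≤pentagonalQ 1≤m′ k) k≤N)))) ⟩
      pentagonalTerm k y ∎
      where
      eP = pentagonalP k
      eQ = pentagonalQ k

  ∏-oneBelowMultiples-suc : ∀ s n f →
    ∏[1-q^ oneBelowMultiples (suc s) (suc n) ] f ≗ [1-q^ suc s *ℕ m ∸ 1 ] ∏[1-q^ oneBelowMultiples s n ] f
  ∏-oneBelowMultiples-suc s zero    f y = refl
  ∏-oneBelowMultiples-suc s (suc n) f y = begin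
      ([1-q^ a ] ∏[1-q^ oneBelowMultiples (suc s) (suc n) ] f) y
        ≡⟨ [1-q^]-cong a (∏-oneBelowMultiples-suc s n f) y ⟩
      ([1-q^ a ] [1-q^ top ] ∏[1-q^ oneBelowMultiples s n ] f) y
        ≡⟨ linear-[1-q^] ([1-q^]-linear a) top (∏[1-q^ oneBelowMultiples s n ] f) y ⟩
      ([1-q^ top ] [1-q^ a ] ∏[1-q^ oneBelowMultiples s n ] f) y
        ≡⟨ cong (λ b → ([1-q^ top ] [1-q^ b ] ∏[1-q^ oneBelowMultiples s n ] f) y) a≡ ⟩
      ([1-q^ top ] [1-q^ s *ℕ m ∸ suc (n *ℕ m) ] ∏[1-q^ oneBelowMultiples s n ] f) y ∎
    where
    open ≡-Reasoning
    a = suc s *ℕ m ∸ suc (suc n *ℕ m)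
    top = suc s *ℕ m ∸ 1
    a≡ : a ≡ s *ℕ m ∸ suc (n *ℕ m)
    a≡ = trans (cong (m +ℕ s *ℕ m ∸_) (sym (ℕ.+-suc m (n *ℕ m)))) (ℕ.[m+n]∸[m+o]≡n∸o m (s *ℕ m) (suc (n *ℕ m)))

  qPoch-jacobiProduct-suc : ∀ N →
    qPoch (suc N) (jacobiProduct (suc N)) ≗
      [1-q^ suc N *ℕ m ] [1-q^ suc (N *ℕ m) ] [1-q^ suc N *ℕ m ∸ 1 ] qPoch N (jacobiProduct N)
  qPoch-jacobiProduct-suc N = [1-q^]-cong (suc N *ℕ m) λ z →
      trans (linear-[1-q^] (qPoch-linear N) (suc (N *ℕ m)) _ z)
            ([1-q^]-cong (suc (N *ℕ m)) (λ w → trans (≗-cong (qPoch-linear N) inner w) (linear-[1-q^] (qPoch-linear N) top (jacobiProduct N) w)) z)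
    where
    top = suc N *ℕ m ∸ 1
    inner : ∏[1-q^ oneAboveMultiples N ] ∏[1-q^ oneBelowMultiples (suc N) (suc N) ] 𝟙 ≗ [1-q^ top ] jacobiProduct N
    inner z = trans (≗-cong (∏[1-q^]-linear (oneAboveMultiples N)) (∏-oneBelowMultiples-suc N N 𝟙) z)
                    (sym (linear-∏[1-q^] ([1-q^]-linear top) (oneAboveMultiples N) (∏[1-q^ oneBelowMultiples N N ] 𝟙) z))

-- Partitions into allowed parts

when : ∀ {A : Set} → Dec A → ℕ → ℕ
when (yes _) x = x
when (no _)  x = 0

when-yes : ∀ {A : Set} (d : Dec A) → A → ∀ x → when d x ≡ x
when-yes (yes _) a  x = refl
when-yes (no ¬a) a  x = ⊥-elim (¬a a)

when-no : ∀ {A : Set} (d : Dec A) → ¬ A → ∀ x → when d x ≡ 0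
when-no (yes a) ¬a x = ⊥-elim (¬a a)
when-no (no _)  ¬a x = refl

when-≤-suc : ∀ a b x → when (suc a ≤? suc b) x ≡ when (a ≤? b) x
when-≤-suc a b x with suc a ≤? suc b | a ≤? b
... | yes _       | yes _  = refl
... | no _        | no _   = refl
... | yes (s≤s p) | no ¬p  = ⊥-elim (¬p p)
... | no ¬p       | yes p  = ⊥-elim (¬p (s≤s p))

Σℕ< : ℕ → (ℕ → ℕ) → ℕ
Σℕ< zero    g = 0
Σℕ< (suc k) g = g 0 +ℕ Σℕ< k (g ∘ suc)

Σℕ<-last : ∀ k g → Σℕ< (suc k) g ≡ Σℕ< k g +ℕ g k
Σℕ<-last zero    g = ℕ.+-comm (g 0) 0
Σℕ<-last (suc k) g = trans (cong (g 0 +ℕ_) (Σℕ<-last k (g ∘ suc))) (sym (ℕ.+-assoc (g 0) _ _))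

Σℕ<-cong : ∀ k {g h : ℕ → ℕ} → (∀ {i} → i < k → g i ≡ h i) → Σℕ< k g ≡ Σℕ< k h
Σℕ<-cong zero    e = refl
Σℕ<-cong (suc k) e = cong₂ _+ℕ_ (e (s≤s z≤n)) (Σℕ<-cong k (e ∘ s≤s))

Σℕ<-0 : ∀ k → Σℕ< k (λ _ → 0) ≡ 0
Σℕ<-0 zero    = refl
Σℕ<-0 (suc k) = Σℕ<-0 k

Σℕ<-when-≤ : ∀ K k h → Σℕ< K (λ i → when (suc i ≤? k) (h i)) ≡ Σℕ< (K ⊓ k) h
Σℕ<-when-≤ zero    k       h = refl
Σℕ<-when-≤ (suc K) zero    h = trans (Σℕ<-cong (suc K) (λ {i} _ → when-no (suc i ≤? 0) (λ ()) (h i))) (Σℕ<-0 (suc K))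
Σℕ<-when-≤ (suc K) (suc k) h = cong₂ _+ℕ_ (when-yes (1 ≤? suc k) (s≤s z≤n) (h 0))
  (trans (Σℕ<-cong K (λ {i} _ → when-≤-suc (suc i) k (h (suc i)))) (Σℕ<-when-≤ K k (h ∘ suc)))

sum-map-filter-≤ : ∀ (G : ℕ → ℕ) k xs → sum (map G (filter (_≤? k) xs)) ≡ sum (map (λ x → when (x ≤? k) (G x)) xs)
sum-map-filter-≤ G k []       = refl
sum-map-filter-≤ G k (x ∷ xs) with x ≤? k
... | yes x≤k = trans (cong (sum ∘ map G) (filter-accept (_≤? k) x≤k)) (cong (G x +ℕ_) (sum-map-filter-≤ G k xs))
... | no  x≰k = trans (cong (sum ∘ map G) (filter-reject (_≤? k) x≰k)) (sum-map-filter-≤ G k xs)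

sum-map-applyUpTo : ∀ (G : ℕ → ℕ) N (f : ℕ → ℕ) → sum (map G (map suc (applyUpTo f N))) ≡ Σℕ< N (λ i → G (suc (f i)))
sum-map-applyUpTo G zero    f = refl
sum-map-applyUpTo G (suc N) f = cong (G (suc (f 0)) +ℕ_) (sum-map-applyUpTo G N (f ∘ suc))

module RestrictedPartitions (m : ℕ) where

  private
    ok = all? (allowed? m)

  countGen : ℕ → ℕ → ℕ → ℕ
  countGen fuel k n = length (filter ok (gen fuel k n))

  length-filter-map-∷ : ∀ j xss → length (filter ok (map (j ∷_) xss)) ≡ when (allowed? m j) (length (filter ok xss))
  length-filter-map-∷ j xss with allowed? m j
  ... | yes a = keep xss
    where
    keep : ∀ xss → length (filter ok (map (j ∷_) xss)) ≡ length (filter ok xss)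
    keep []         = refl
    keep (xs ∷ xss) = by (ok xs)
      where
      by : Dec (All (Allowed m) xs) → length (filter ok (map (j ∷_) (xs ∷ xss))) ≡ length (filter ok (xs ∷ xss))
      by (yes all) = trans (cong length (filter-accept ok {x = j ∷ xs} (a ∷ all)))
                           (trans (cong suc (keep xss)) (sym (cong length (filter-accept ok {x = xs} {xs = xss} all))))
      by (no ¬all) = trans (cong length (filter-reject ok {x = j ∷ xs} λ { (_ ∷ all) → ¬all all }))
                           (trans (keep xss) (sym (cong length (filter-reject ok {x = xs} {xs = xss} ¬all))))
  ... | no ¬a = drop xss
    where
    drop : ∀ xss → length (filter ok (map (j ∷_) xss)) ≡ 0
    drop []         = refl
    drop (xs ∷ xss) = trans (cong length (filter-reject ok {x = j ∷ xs} λ { (a ∷ _) → ¬a a })) (drop xss)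

  length-filter-concatMap : ∀ (F : ℕ → List (List ℕ)) js →
    length (filter ok (concatMap F js)) ≡ sum (map (λ j → length (filter ok (F j))) js)
  length-filter-concatMap F []       = refl
  length-filter-concatMap F (j ∷ js) =
    trans (cong length (filter-++ ok (F j) (concatMap F js)))
          (trans (length-++ (filter ok (F j))) (cong (length (filter ok (F j)) +ℕ_) (length-filter-concatMap F js)))

  -- contributions of the partitions of suc n whose largest part is suc i
  largestPart : ℕ → ℕ → ℕ → ℕ
  largestPart fuel n i = when (allowed? m (suc i)) (countGen fuel (suc i) (n ∸ i))

  countGen-suc : ∀ fuel k n → countGen (suc fuel) k (suc n) ≡ Σℕ< (suc n ⊓ k) (largestPart fuel n)
  countGen-suc fuel k n = begin
      countGen (suc fuel) k (suc n)
        ≡⟨ length-filter-concatMap F (filter (_≤? k) (map suc (upTo (suc n)))) ⟩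
      sum (map G (filter (_≤? k) (map suc (upTo (suc n)))))
        ≡⟨ sum-map-filter-≤ G k (map suc (upTo (suc n))) ⟩
      sum (map (λ x → when (x ≤? k) (G x)) (map suc (upTo (suc n))))
        ≡⟨ sum-map-applyUpTo (λ x → when (x ≤? k) (G x)) (suc n) (λ i → i) ⟩
      Σℕ< (suc n) (λ i → when (suc i ≤? k) (G (suc i)))
        ≡⟨ Σℕ<-cong (suc n) (λ {i} _ → cong (when (suc i ≤? k)) (length-filter-map-∷ (suc i) (gen fuel (suc i) (n ∸ i)))) ⟩
      Σℕ< (suc n) (λ i → when (suc i ≤? k) (largestPart fuel n i))
        ≡⟨ Σℕ<-when-≤ (suc n) k (largestPart fuel n) ⟩
      Σℕ< (suc n ⊓ k) (largestPart fuel n) ∎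
    where
    open ≡-Reasoning
    F = λ j → map (j ∷_) (gen fuel j (suc n ∸ j))
    G = λ j → length (filter ok (F j))

  countGen-fuel : ∀ {fuel fuel′} k n → n ≤ fuel → n ≤ fuel′ → countGen fuel k n ≡ countGen fuel′ k n
  countGen-fuel                        k zero    _ _ = refl
  countGen-fuel {suc fuel} {suc fuel′} k (suc n) (s≤s n≤f) (s≤s n≤f′) =
    trans (countGen-suc fuel k n)
          (trans (Σℕ<-cong (suc n ⊓ k) (λ {i} _ → cong (when (allowed? m (suc i)))
                   (countGen-fuel (suc i) (n ∸ i) (ℕ.≤-trans (ℕ.m∸n≤m n i) n≤f) (ℕ.≤-trans (ℕ.m∸n≤m n i) n≤f′))))
                 (sym (countGen-suc fuel′ k n)))

  count : ℕ → ℕ → ℕ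
  count L n = countGen n L n

  count-unrestricted : ∀ {L} n → n ≤ L → count L n ≡ p′ m n
  count-unrestricted zero    _   = refl
  count-unrestricted {L} (suc n) n<L = begin
    count L (suc n)                         ≡⟨ countGen-suc n L n ⟩
    Σℕ< (suc n ⊓ L) (largestPart n n)       ≡⟨ cong (λ k → Σℕ< k (largestPart n n)) (trans (ℕ.m≤n⇒m⊓n≡m n<L) (sym (ℕ.⊓-idem (suc n)))) ⟩
    Σℕ< (suc n ⊓ suc n) (largestPart n n)   ≡⟨ countGen-suc n (suc n) n ⟨
    p′ m (suc n)                            ∎
    where open ≡-Reasoning

  largestPart-count : ∀ n L → largestPart n n L ≡ when (allowed? m (suc L)) (count (suc L) (n ∸ L))
  largestPart-count n L = cong (when (allowed? m (suc L))) (countGen-fuel (suc L) (n ∸ L) (ℕ.m∸n≤m n L) ℕ.≤-refl)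

  count-suc-≤ : ∀ {L n} → L ≤ n → count (suc L) (suc n) ≡ count L (suc n) +ℕ largestPart n n L
  count-suc-≤ {L} {n} L≤n = begin
    count (suc L) (suc n)                              ≡⟨ countGen-suc n (suc L) n ⟩
    Σℕ< (suc (n ⊓ L)) (largestPart n n)                ≡⟨ cong (λ k → Σℕ< (suc k) (largestPart n n)) (ℕ.m≥n⇒m⊓n≡n L≤n) ⟩
    Σℕ< (suc L) (largestPart n n)                      ≡⟨ Σℕ<-last L (largestPart n n) ⟩
    Σℕ< L (largestPart n n) +ℕ largestPart n n L       ≡⟨ cong (λ k → Σℕ< k (largestPart n n) +ℕ largestPart n n L) (ℕ.m≥n⇒m⊓n≡n (ℕ.m≤n⇒m≤1+n L≤n)) ⟨
    Σℕ< (suc n ⊓ L) (largestPart n n) +ℕ largestPart n n L ≡⟨ cong (_+ℕ largestPart n n L) (countGen-suc n L n) ⟨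
    count L (suc n) +ℕ largestPart n n L               ∎
    where open ≡-Reasoning

  count-suc-> : ∀ {L n} → n < L → count (suc L) (suc n) ≡ count L (suc n)
  count-suc-> {L} {n} n<L = begin
    count (suc L) (suc n)                ≡⟨ countGen-suc n (suc L) n ⟩
    Σℕ< (suc (n ⊓ L)) (largestPart n n)  ≡⟨ cong (λ k → Σℕ< (suc k) (largestPart n n)) (ℕ.m≤n⇒m⊓n≡m (ℕ.<⇒≤ n<L)) ⟩
    Σℕ< (suc n) (largestPart n n)        ≡⟨ cong (λ k → Σℕ< k (largestPart n n)) (ℕ.m≤n⇒m⊓n≡m n<L) ⟨
    Σℕ< (suc n ⊓ L) (largestPart n n)    ≡⟨ countGen-suc n L n ⟨
    count L (suc n)                      ∎
    where open ≡-Reasoning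

  partitionSeries : ℕ → Series
  partitionSeries L n = + count L n

  partitionSeries-0 : partitionSeries 0 ≗ 𝟙
  partitionSeries-0 zero    = refl
  partitionSeries-0 (suc n) = cong +_ (countGen-suc n 0 n)

  partitionSeries-allowed : ∀ L → Allowed m (suc L) → [1-q^ suc L ] partitionSeries (suc L) ≗ partitionSeries L
  partitionSeries-allowed L a zero = refl
  partitionSeries-allowed L a (suc n) with L ≤? n
  ... | yes L≤n = begin
      + count (suc L) (suc n) -ᶻ shift L (partitionSeries (suc L)) n
        ≡⟨ cong₂ (λ u v → + u -ᶻ v) (count-suc-≤ L≤n) (shift-∸ (partitionSeries (suc L)) L≤n) ⟩
      + (count L (suc n) +ℕ largestPart n n L) -ᶻ + count (suc L) (n ∸ L)
        ≡⟨ cong (λ z → + (count L (suc n) +ℕ z) -ᶻ + count (suc L) (n ∸ L))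
                (trans (largestPart-count n L) (when-yes (allowed? m (suc L)) a _)) ⟩
      (+ count L (suc n) +ᶻ + count (suc L) (n ∸ L)) -ᶻ + count (suc L) (n ∸ L)
        ≡⟨ cancel (+ count L (suc n)) (+ count (suc L) (n ∸ L)) ⟩
      + count L (suc n) ∎
    where
    open ≡-Reasoning
    cancel : ∀ x y → (x +ᶻ y) -ᶻ y ≡ x
    cancel = solve-∀
  ... | no L≰n = trans (cong₂ (λ u v → + u -ᶻ v) (count-suc-> (ℕ.≰⇒> L≰n)) (shift-below L (partitionSeries (suc L)) (ℕ.≰⇒> L≰n)))
                       (ℤ.+-identityʳ _)

  partitionSeries-forbidden : ∀ L → ¬ Allowed m (suc L) → partitionSeries (suc L) ≗ partitionSeries L
  partitionSeries-forbidden L ¬a zero = refl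
  partitionSeries-forbidden L ¬a (suc n) with L ≤? n
  ... | yes L≤n = cong +_ (trans (count-suc-≤ L≤n)
                                 (trans (cong (count L (suc n) +ℕ_) (trans (largestPart-count n L) (when-no (allowed? m (suc L)) ¬a _)))
                                        (ℕ.+-identityʳ _)))
  ... | no L≰n = cong +_ (count-suc-> (ℕ.≰⇒> L≰n))

  factorWhen : ∀ {A : Set} → Dec A → ℕ → Series → Series
  factorWhen (yes _) a f = [1-q^ a ] f
  factorWhen (no _)  a f = f

  allowedProduct : ℕ → Series
  allowedProduct zero    = 𝟙
  allowedProduct (suc L) = factorWhen (allowed? m (suc L)) (suc L) (allowedProduct L)

  allowedProduct-allowed : ∀ L → Allowed m (suc L) → allowedProduct (suc L) ≡ [1-q^ suc L ] allowedProduct L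
  allowedProduct-allowed L a with allowed? m (suc L)
  ... | yes _ = refl
  ... | no ¬a = ⊥-elim (¬a a)

  allowedProduct-forbidden : ∀ L → ¬ Allowed m (suc L) → allowedProduct (suc L) ≡ allowedProduct L
  allowedProduct-forbidden L ¬a with allowed? m (suc L)
  ... | yes a = ⊥-elim (¬a a)
  ... | no _  = refl

  allowedProduct-∗-partitionSeries : ∀ L → allowedProduct L ∗ partitionSeries L ≗ 𝟙
  allowedProduct-∗-partitionSeries zero    n = trans (𝟙-∗ (partitionSeries 0) n) (partitionSeries-0 n)
  allowedProduct-∗-partitionSeries (suc L) n with allowed? m (suc L)
  ... | yes a = begin
      ([1-q^ suc L ] allowedProduct L ∗ partitionSeries (suc L)) n
        ≡⟨ [1-q^]-∗ (suc L) (allowedProduct L) (partitionSeries (suc L)) n ⟩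
      (allowedProduct L ∗ [1-q^ suc L ] partitionSeries (suc L)) n
        ≡⟨ ∗-cong {f = allowedProduct L} (λ _ → refl) (partitionSeries-allowed L a) n ⟩
      (allowedProduct L ∗ partitionSeries L) n
        ≡⟨ allowedProduct-∗-partitionSeries L n ⟩
      𝟙 n ∎
    where open ≡-Reasoning
  ... | no ¬a = trans (∗-cong {f = allowedProduct L} (λ _ → refl) (partitionSeries-forbidden L ¬a) n)
                      (allowedProduct-∗-partitionSeries L n)

-- The recurrence

halve : ∀ {a b} → b ≡ a *ℕ 2 → b / 2 ≡ a
halve {a} b≡ = trans (cong (_/ 2) b≡) (m*n/n≡m a 2)

module PentagonalRecurrence (r : ℕ) where

  open JacobiTripleProduct (suc (suc r))
  open RestrictedPartitions m

  residue-forbidden : ∀ N {t} → 1 ≤ t → t ≤ r → ¬ Allowed m (suc t +ℕ N *ℕ m)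
  residue-forbidden N {t} 1≤t t≤r = λ
    { (inj₁ m∣)        → excluded (suc t) (s≤s z≤n) (s≤s (s≤s (ℕ.m≤n⇒m≤1+n t≤r))) m∣
    ; (inj₂ (inj₁ m∣)) → excluded t 1≤t (ℕ.≤-trans (s≤s t≤r) (ℕ.≤-trans (ℕ.n≤1+n _) (ℕ.n≤1+n _))) m∣
    ; (inj₂ (inj₂ m∣)) → excluded (suc (suc t)) (s≤s z≤n) (s≤s (s≤s (s≤s t≤r))) (subst (m ∣_) (ℕ.+-comm (suc t +ℕ N *ℕ m) 1) m∣)
    }
    where
    excluded : ∀ i → 0 < i → i < m → ¬ (m ∣ i +ℕ N *ℕ m)
    excluded i 0<i i<m m∣ = >⇒∤ i<m (∣m+n∣m⇒∣n (subst (m ∣_) (ℕ.+-comm i (N *ℕ m)) m∣) (n∣m*n N))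
      where instance _ = >-nonZero 0<i

  allowedProduct-gap : ∀ N {t} → t ≤ r → allowedProduct (suc (t +ℕ N *ℕ m)) ≡ [1-q^ suc (N *ℕ m) ] allowedProduct (N *ℕ m)
  allowedProduct-gap N {zero}  _   = allowedProduct-allowed (N *ℕ m) (inj₂ (inj₁ (n∣m*n N)))
  allowedProduct-gap N {suc t} t<r =
    trans (allowedProduct-forbidden (suc (t +ℕ N *ℕ m)) (residue-forbidden N (s≤s z≤n) t<r))
          (allowedProduct-gap N (ℕ.<⇒≤ t<r))

  -- the allowed parts in ((N - 1) m, N m] are N m - 1, N m and (N - 1) m + 1
  allowedProduct-multiple : ∀ N → allowedProduct (N *ℕ m) ≗ qPoch N (jacobiProduct N)
  allowedProduct-multiple zero    y = refl
  allowedProduct-multiple (suc N) y = begin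
      allowedProduct (suc N *ℕ m) y
        ≡⟨ cong (λ f → f y) (allowedProduct-allowed (suc (suc (r +ℕ N *ℕ m))) (inj₁ (n∣m*n (suc N)))) ⟩
      ([1-q^ suc N *ℕ m ] allowedProduct (suc (suc (r +ℕ N *ℕ m)))) y
        ≡⟨ cong (λ f → ([1-q^ suc N *ℕ m ] f) y) (allowedProduct-allowed (suc (r +ℕ N *ℕ m)) (inj₂ (inj₂ m∣))) ⟩
      ([1-q^ suc N *ℕ m ] [1-q^ a ] allowedProduct (suc (r +ℕ N *ℕ m))) y
        ≡⟨ cong (λ f → ([1-q^ suc N *ℕ m ] [1-q^ a ] f) y) (allowedProduct-gap N ℕ.≤-refl) ⟩
      ([1-q^ suc N *ℕ m ] [1-q^ a ] [1-q^ b ] allowedProduct (N *ℕ m)) y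
        ≡⟨ [1-q^]-cong (suc N *ℕ m) (linear-[1-q^] ([1-q^]-linear a) b (allowedProduct (N *ℕ m))) y ⟩
      ([1-q^ suc N *ℕ m ] [1-q^ b ] [1-q^ a ] allowedProduct (N *ℕ m)) y
        ≡⟨ [1-q^]-cong (suc N *ℕ m) ([1-q^]-cong b ([1-q^]-cong a (allowedProduct-multiple N))) y ⟩
      ([1-q^ suc N *ℕ m ] [1-q^ b ] [1-q^ a ] qPoch N (jacobiProduct N)) y
        ≡⟨ qPoch-jacobiProduct-suc N y ⟨
      qPoch (suc N) (jacobiProduct (suc N)) y ∎
    where
    open ≡-Reasoning
    a = suc N *ℕ m ∸ 1
    b = suc (N *ℕ m)
    m∣ : m ∣ suc (suc (r +ℕ N *ℕ m)) +ℕ 1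
    m∣ = subst (m ∣_) (ℕ.+-comm 1 (suc (suc (r +ℕ N *ℕ m)))) (n∣m*n (suc N))

  -- rewriting r + 2 to 2 + r lets the truncated subtractions in P and Q compute
  P-pentagonal : ∀ k → P (m +ℕ 2) k ≡ pentagonalP k
  P-pentagonal zero    = refl
  P-pentagonal (suc k) rewrite ℕ.+-comm r 2 = halve (begin
      suc k *ℕ (m *ℕ suc k ∸ suc r)                                ≡⟨ cong (suc k *ℕ_) difference ⟩
      suc k *ℕ (2 +ℕ m *ℕ k)                                       ≡⟨ expand k m ⟩
      2 +ℕ 2 *ℕ k +ℕ m *ℕ k +ℕ m *ℕ (k *ℕ k)                       ≡⟨ cong (λ z → 2 +ℕ 2 *ℕ k +ℕ m *ℕ k +ℕ m *ℕ z) (choose₂-double k) ⟨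
      2 +ℕ 2 *ℕ k +ℕ m *ℕ k +ℕ m *ℕ (choose₂ k +ℕ choose₂ k +ℕ k) ≡⟨ regroup k (choose₂ k) m ⟩
      pentagonalP (suc k) *ℕ 2                                     ∎)
    where
    open ≡-Reasoning
    difference : m *ℕ suc k ∸ suc r ≡ 2 +ℕ m *ℕ k
    difference = trans (cong (_∸ suc r) (split r k)) (ℕ.m+n∸m≡n (suc r) (2 +ℕ m *ℕ k))
      where
      split : ∀ r k → suc (suc (suc r)) *ℕ suc k ≡ suc r +ℕ (2 +ℕ suc (suc (suc r)) *ℕ k)
      split = solve-∀ℕ
    expand : ∀ k m → suc k *ℕ (2 +ℕ m *ℕ k) ≡ 2 +ℕ 2 *ℕ k +ℕ m *ℕ k +ℕ m *ℕ (k *ℕ k)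
    expand = solve-∀ℕ
    regroup : ∀ k T m → 2 +ℕ 2 *ℕ k +ℕ m *ℕ k +ℕ m *ℕ (T +ℕ T +ℕ k) ≡ (suc k +ℕ (T +ℕ k) *ℕ m) *ℕ 2
    regroup = solve-∀ℕ

  Q-pentagonal : ∀ k → Q (m +ℕ 2) k ≡ pentagonalQ k
  Q-pentagonal k rewrite ℕ.+-comm r 2 = halve (begin
      k *ℕ (m *ℕ k +ℕ suc r)                       ≡⟨ expand k r ⟩
      m *ℕ (k *ℕ k) +ℕ k *ℕ suc r                  ≡⟨ cong (λ z → m *ℕ z +ℕ k *ℕ suc r) (choose₂-double k) ⟨
      m *ℕ (choose₂ k +ℕ choose₂ k +ℕ k) +ℕ k *ℕ suc r ≡⟨ regroup k (choose₂ k) r ⟩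
      pentagonalQ k *ℕ 2                           ∎)
    where
    open ≡-Reasoning
    expand : ∀ k r → k *ℕ (suc (suc (suc r)) *ℕ k +ℕ suc r) ≡ suc (suc (suc r)) *ℕ (k *ℕ k) +ℕ k *ℕ suc r
    expand = solve-∀ℕ
    regroup : ∀ k T r → suc (suc (suc r)) *ℕ (T +ℕ T +ℕ k) +ℕ k *ℕ suc r ≡ (k *ℕ suc (suc r) +ℕ T *ℕ suc (suc (suc r))) *ℕ 2
    regroup = solve-∀ℕ

  p′-series : Series
  p′-series n = + p′ m n

  shift-p′-series : ∀ e n → shift e p′-series n ≡ p′ℤ m (+ n -ᶻ + e)
  shift-p′-series e n with n ℕ.<? e
  ... | yes n<e = begin
      shift e p′-series n               ≡⟨ shift-below e p′-series n<e ⟩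
      + 0                               ≡⟨⟩
      p′ℤ m -[1+ e ∸ suc n ]            ≡⟨ cong (λ z → p′ℤ m (-ᶻ + z)) (ℕ.+-∸-assoc 1 n<e) ⟨
      p′ℤ m (-ᶻ + (e ∸ n))              ≡⟨ cong (p′ℤ m) (ℤ.⊖-< n<e) ⟨
      p′ℤ m (n ⊖ e)                   ≡⟨ cong (p′ℤ m) (ℤ.m-n≡m⊖n n e) ⟨
      p′ℤ m (+ n -ᶻ + e)                ∎
    where open ≡-Reasoning
  ... | no n≮e = begin
      shift e p′-series n               ≡⟨ shift-∸ p′-series e≤n ⟩
      + p′ m (n ∸ e)                    ≡⟨ cong (p′ℤ m) (ℤ.⊖-≥ e≤n) ⟨
      p′ℤ m (n ⊖ e)                   ≡⟨ cong (p′ℤ m) (ℤ.m-n≡m⊖n n e) ⟨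
      p′ℤ m (+ n -ᶻ + e)                ∎
    where
    open ≡-Reasoning
    e≤n = ℕ.≮⇒≥ n≮e

  pentagonalTerm-∗ : ∀ n k → (pentagonalTerm k ∗ p′-series) n ≡ -ᶻ term m n k
  pentagonalTerm-∗ n k = begin
      (pentagonalTerm k ∗ p′-series) n
        ≡⟨ ⊙-hom (∗-linearˡ p′-series) (sign k) (shift (pentagonalP k) 𝟙 ⊕ shift (pentagonalQ k) 𝟙) n ⟩
      sign k *ᶻ ((shift (pentagonalP k) 𝟙 ⊕ shift (pentagonalQ k) 𝟙) ∗ p′-series) n
        ≡⟨ cong (sign k *ᶻ_) (⊕-hom (∗-linearˡ p′-series) (shift (pentagonalP k) 𝟙) (shift (pentagonalQ k) 𝟙) n) ⟩
      sign k *ᶻ ((shift (pentagonalP k) 𝟙 ∗ p′-series) n +ᶻ (shift (pentagonalQ k) 𝟙 ∗ p′-series) n)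
        ≡⟨ cong (sign k *ᶻ_) (cong₂ _+ᶻ_ (at (pentagonalP k) (P-pentagonal k)) (at (pentagonalQ k) (Q-pentagonal k))) ⟩
      sign k *ᶻ X
        ≡⟨ ℤ.neg-involutive (sign k *ᶻ X) ⟨
      -ᶻ (-ᶻ (sign k *ᶻ X))
        ≡⟨ cong -ᶻ_ (sign-suc k X) ⟨
      -ᶻ (sign (suc k) *ᶻ X)
        ≡⟨ cong (λ j → -ᶻ (sign j *ᶻ X)) (ℕ.+-comm 1 k) ⟩
      -ᶻ term m n k ∎
    where
    open ≡-Reasoning
    X = p′ℤ m (+ n -ᶻ + P (m +ℕ 2) k) +ᶻ p′ℤ m (+ n -ᶻ + Q (m +ℕ 2) k)
    at : ∀ e {e′} → e′ ≡ e → (shift e 𝟙 ∗ p′-series) n ≡ p′ℤ m (+ n -ᶻ + e′)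
    at e refl = trans (shift-𝟙-∗ e p′-series n) (shift-p′-series e n)

  pentagonalSum-∗ : ∀ n → (pentagonalSum n ∗ p′-series) n ≡ + p′ m n -ᶻ sumFrom1 n (term m n)
  pentagonalSum-∗ n = begin
      (pentagonalSum n ∗ p′-series) n
        ≡⟨ ⊕-hom (∗-linearˡ p′-series) 𝟙 (sumFrom1ˢ n pentagonalTerm) n ⟩
      (𝟙 ∗ p′-series) n +ᶻ (sumFrom1ˢ n pentagonalTerm ∗ p′-series) n
        ≡⟨ cong₂ _+ᶻ_ (𝟙-∗ p′-series n) (linear-sumFrom1ˢ (∗-linearˡ p′-series) n pentagonalTerm n) ⟩
      + p′ m n +ᶻ sumFrom1 n (λ k → (pentagonalTerm k ∗ p′-series) n)
        ≡⟨ cong (+ p′ m n +ᶻ_) (sumFrom1-cong n (λ {k} _ _ → pentagonalTerm-∗ n k)) ⟩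
      + p′ m n +ᶻ sumFrom1 n (λ k → -ᶻ term m n k)
        ≡⟨ cong (+ p′ m n +ᶻ_) (sumFrom1-neg n (term m n)) ⟩
      + p′ m n -ᶻ sumFrom1 n (term m n) ∎
    where open ≡-Reasoning

  allowedProduct-≡-pentagonalSum : ∀ n → allowedProduct (n *ℕ m) ≡ pentagonalSum n mod-q^ suc n
  allowedProduct-≡-pentagonalSum n {y} y≤n =
    trans (allowedProduct-multiple n y)
          (trans (≗-cong (qPoch-linear n) (jacobiProduct-sum n) y) (qPoch-jacobiSum (s≤s z≤n) n y≤n))

  partitionSeries-≡-p′-series : ∀ n → partitionSeries (n *ℕ m) ≡ p′-series mod-q^ suc n
  partitionSeries-≡-p′-series n {j} (s≤s j≤n) = cong +_ (count-unrestricted j (ℕ.≤-trans j≤n (ℕ.m≤m*n n m)))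

  -- p′_m is inverse to the allowed product, which agrees with the pentagonal sum below degree n + 1
  pentagonalSum-∗-vanishes : ∀ {n} → 1 ≤ n → (pentagonalSum n ∗ p′-series) n ≡ 0ℤ
  pentagonalSum-∗-vanishes {suc n} _ = begin
      (pentagonalSum (suc n) ∗ p′-series) (suc n)
        ≡⟨ ∗-mod (λ y≤n → sym (allowedProduct-≡-pentagonalSum (suc n) y≤n)) (λ j≤n → sym (partitionSeries-≡-p′-series (suc n) j≤n)) ⟩
      (allowedProduct (suc n *ℕ m) ∗ partitionSeries (suc n *ℕ m)) (suc n)
        ≡⟨ allowedProduct-∗-partitionSeries (suc n *ℕ m) (suc n) ⟩
      0ℤ ∎
    where open ≡-Reasoning

  p′-recurrence : ∀ {n} → 1 ≤ n → + p′ m n ≡ sumFrom1 n (term m n)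
  p′-recurrence {n} 1≤n = ℤ.i-j≡0⇒i≡j _ _ (trans (sym (pentagonalSum-∗ n)) (pentagonalSum-∗-vanishes 1≤n))

  term-vanishes : ∀ {n k} → n < k → term m n k ≡ 0ℤ
  term-vanishes {n} {k} n<k = begin
      sign (k +ℕ 1) *ᶻ (p′ℤ m (+ n -ᶻ + P (m +ℕ 2) k) +ᶻ p′ℤ m (+ n -ᶻ + Q (m +ℕ 2) k))
        ≡⟨ cong (sign (k +ℕ 1) *ᶻ_) (cong₂ _+ᶻ_ (vanish (P (m +ℕ 2) k) (P-pentagonal k) (k≤pentagonalP k))
                                                (vanish (Q (m +ℕ 2) k) (Q-pentagonal k) (k≤pentagonalQ (s≤s z≤n) k))) ⟩
      sign (k +ℕ 1) *ᶻ 0ℤ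
        ≡⟨ ℤ.*-zeroʳ (sign (k +ℕ 1)) ⟩
      0ℤ ∎
    where
    open ≡-Reasoning
    vanish : ∀ e {e′} → e ≡ e′ → k ≤ e′ → p′ℤ m (+ n -ᶻ + e) ≡ 0ℤ
    vanish e refl k≤e = trans (sym (shift-p′-series e n)) (shift-below e p′-series (ℕ.<-≤-trans n<k k≤e))

  sumFrom1-term-stable : ∀ {n N} → n ≤ N → sumFrom1 N (term m n) ≡ sumFrom1 n (term m n)
  sumFrom1-term-stable {n} {N} n≤N with ℕ.m≤n⇒m<n∨m≡n n≤N
  ... | inj₂ refl          = refl
  ... | inj₁ (s≤s n≤N′) =
    trans (cong₂ _+ᶻ_ (sumFrom1-term-stable n≤N′) (term-vanishes (s≤s n≤N′))) (ℤ.+-identityʳ _)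

theorem6 : (m n : ℕ) → 3 ≤ m → 1 ≤ n → (N : ℕ) → n ≤ N →
    + (p′ m n) ≡ sumFrom1 N (term m n)
theorem6 (suc (suc (suc r))) n (s≤s (s≤s (s≤s _))) 1≤n N n≤N =
  trans (p′-recurrence 1≤n) (sym (sumFrom1-term-stable n≤N))
  where open PentagonalRecurrence r
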